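{- Let $n\geq 4$, let $G=(V,E)$ be the rook's graph $K_4\square K_n$ and let $\alpha^*$ be a nice elimination ordering over $G$ such that $\mathcal{V}_G(\alpha^*,n+2)=\alpha^*[1,|\mathcal{V}_G(\alpha^*,n+2)|]$ and $\mathrm{tw}(G^+_{\alpha^*})=\mathrm{tw}(G)$. Then for any step $j\in\{|\mathcal{V}_G(\alpha^*,n+2)|+1,\dots,2n-2\}$ such that $|\mathcal{M}_{\alpha^*}(j)|=2$, writing $X=V_{\mathrm{comp}_{\alpha^*}(j)}$, $$\sum_{v\in X}|\mathrm{madj}^+_{\alpha^*}(v)|\geq\begin{cases}2n(|X|-1)+\lceil |X|/2\rceil+3 & \text{if } |\mathcal{V}_G(\alpha^*,n+2)\cap X|=2,\\ 2n(|X|-1)+\lceil |X|/2\rceil+5 & \text{otherwise.}\end{cases}$$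
   Context: The rook's graph $K_m\square K_n$ has vertex set $\{v_{r,c}: 1\le r\le m, 1\le c\le n\}$, with $v_{r,c}\sim v_{r',c'}$ iff exactly one of $r=r'$, $c=c'$ holds. For a graph $G=(V,E)$, an elimination ordering is a bijection $\alpha:\{1,\dots,|V|\}\to V$; $\alpha[i,j]=\{\alpha(t): i\le t\le j\}$. Elimination game: $G_0=G$, and $G_i$ is obtained from $G_{i-1}$ by making $N_{G_{i-1}}(\alpha(i))$ a clique and deleting $\alpha(i)$; for a vertex $v=\alpha(i)$, $\mathrm{madj}^+_\alpha(v):=N_{G_{i-1}}(v)$. The filled graph $G^+_\alpha$ is $G$ together with all edges added during the game. $\mathrm{tw}$ is treewidth. $\alpha$ is nice if $|\mathrm{madj}^+_\alpha(\alpha(i))|=|V|-i$ for every $i\in\{|V|-\mathrm{tw}(G^+_\alpha),\dots,|V|\}$. For an integer $k$, $\mathcal{V}_G(\alpha,k)=\{\alpha(i): 1\le i\le |V|-(k+1),\ |\mathrm{madj}^+_\alpha(\alpha(i))|=k\}$. $\mathrm{comp}_\alpha(i)$ is the connected component of $G[\alpha[1,i]]$ containing $\alpha(i)$, with vertex set $V_{\mathrm{comp}_\alpha(i)}$, and $\mathcal{M}_\alpha(i)=\{r: \exists c,\ v_{r,c}\in V_{\mathrm{comp}_\alpha(i)}\}$ is the set of row indices it spans. -}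

module Defs where

open import Data.Nat using (ℕ; zero; suc; _+_; _*_; _∸_; _≤_; _≤ᵇ_; _≡ᵇ_; ⌈_/2⌉)
open import Data.Fin using (Fin; toℕ; zero; suc) renaming (_≟_ to _≟ᶠ_)
open import Data.Bool using (Bool; true; false; _∧_; _∨_; not; _xor_; if_then_else_; T)
open import Data.Product using (_×_; _,_; Σ; ∃)
open import Relation.Nullary.Decidable using (⌊_⌋)
open import Relation.Binary.PropositionalEquality using (_≡_)
open import Function.Bundles using (_↔_; Inverse)

anyFin : ∀ {k} → (Fin k → Bool) → Bool
anyFin {zero} p = false
anyFin {suc k} p = p zero ∨ anyFin (λ i → p (suc i))

sumFin : ∀ {k} → (Fin k → ℕ) → ℕ
sumFin {zero} f = 0
sumFin {suc k} f = f zero + sumFin (λ i → f (suc i))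

countFin : ∀ {k} → (Fin k → Bool) → ℕ
countFin p = sumFin (λ i → if p i then 1 else 0)

Vtx : ℕ → ℕ → Set
Vtx m n = Fin m × Fin n

Graph : ℕ → ℕ → Set
Graph m n = Vtx m n → Vtx m n → Bool

module _ {m n : ℕ} where
  anyV : (Vtx m n → Bool) → Bool
  anyV p = anyFin (λ r → anyFin (λ c → p (r , c)))

  sumV : (Vtx m n → ℕ) → ℕ
  sumV f = sumFin (λ r → sumFin (λ c → f (r , c)))

  countV : (Vtx m n → Bool) → ℕ
  countV p = sumV (λ v → if p v then 1 else 0)

  eqV : Vtx m n → Vtx m n → Bool
  eqV (r , c) (r' , c') = ⌊ r ≟ᶠ r' ⌋ ∧ ⌊ c ≟ᶠ c' ⌋

rook : (m n : ℕ) → Graph m n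
rook m n (r , c) (r' , c') = ⌊ r ≟ᶠ r' ⌋ xor ⌊ c ≟ᶠ c' ⌋

data Walk {m n : ℕ} (G : Graph m n) (S : Vtx m n → Bool) : Vtx m n → Vtx m n → Set where
  here : ∀ {u} → T (S u) → Walk G S u u
  step : ∀ {u v w} → Walk G S u v → T (G v w) → T (S w) → Walk G S u w

-- Tree decompositions and treewidth.
-- A tree with nodes Fin (suc t): node (suc i) has parent (par i), whose
-- index is smaller.  (Every finite tree arises this way, e.g. in BFS order.)

data TreeAdj {t : ℕ} (par : Fin t → Fin (suc t)) : Fin (suc t) → Fin (suc t) → Set where
  up   : ∀ i → TreeAdj par (suc i) (par i)
  down : ∀ i → TreeAdj par (par i) (suc i)

data TreeWalk {t : ℕ} (par : Fin t → Fin (suc t)) (S : Fin (suc t) → Bool)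
     : Fin (suc t) → Fin (suc t) → Set where
  here : ∀ {a} → T (S a) → TreeWalk par S a a
  step : ∀ {a b c} → TreeWalk par S a b → TreeAdj par b c → T (S c) → TreeWalk par S a c

record TreeDecomposition {m n : ℕ} (G : Graph m n) : Set where
  field
    t        : ℕ
    par      : Fin t → Fin (suc t)
    par<     : ∀ i → toℕ (par i) ≤ toℕ i
    bag      : Fin (suc t) → Vtx m n → Bool
    covV     : ∀ v → ∃ λ a → T (bag a v)
    covE     : ∀ u v → T (G u v) → ∃ λ a → T (bag a u) × T (bag a v)
    subtree  : ∀ v a b → T (bag a v) → T (bag b v) → TreeWalk par (λ c → bag c v) a b

WidthAtMost : ∀ {m n} {G : Graph m n} → ℕ → TreeDecomposition G → Set
WidthAtMost k D = ∀ a → countV (TreeDecomposition.bag D a) ≤ suc k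

Treewidth : ∀ {m n} → Graph m n → ℕ → Set
Treewidth G k =
  (Σ (TreeDecomposition G) λ D → WidthAtMost k D) ×
  (∀ (D : TreeDecomposition G) → ∃ λ a → suc k ≤ countV (TreeDecomposition.bag D a))

-- Elimination orderings and the elimination game.
-- Positions are 0-based: paper's α(i) is  ord (i-1).

Ordering : ℕ → ℕ → Set
Ordering m n = Fin (m * n) ↔ Vtx m n

module Elim {m n : ℕ} (G : Graph m n) (α : Ordering m n) where
  N : ℕ
  N = m * n

  ord : Fin N → Vtx m n
  ord = Inverse.to α

  pos : Vtx m n → ℕ
  pos v = toℕ (Inverse.from α v)

  alive : ℕ → Vtx m n → Bool
  alive k v = k ≤ᵇ pos v

  game : ℕ → Graph m n
  game zero = G
  game (suc k) u w = alive (suc k) u ∧ alive (suc k) w ∧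
    (game k u w ∨ anyV (λ x → (pos x ≡ᵇ k) ∧ game k u x ∧ game k x w ∧ not (eqV u w)))

  -- madj⁺(v) = N_{G_{i-1}}(v) where v = α(i)
  madj : Vtx m n → Vtx m n → Bool
  madj v = game (pos v) v

  madjSize : Vtx m n → ℕ
  madjSize v = countV (madj v)

  filled : Graph m n
  filled u w = anyFin {suc N} (λ k → game (toℕ k) u w)

  Nice : Set
  Nice = ∀ w → Treewidth filled w → ∀ (p : Fin N) → N ∸ w ≤ suc (toℕ p) →
         madjSize (ord p) ≡ N ∸ suc (toℕ p)

  inVG : ℕ → Vtx m n → Bool
  inVG k v = (pos v + k + 2 ≤ᵇ N) ∧ (madjSize v ≡ᵇ k)

  prefix : ℕ → Vtx m n → Bool
  prefix s v = suc (pos v) ≤ᵇ s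

  -- v ∈ V_{comp_α(j)}, for the 1-based step  suc (toℕ j)
  InComp : Fin N → Vtx m n → Set
  InComp j v = Walk G (λ u → pos u ≤ᵇ toℕ j) (ord j) v

  -- |ℳ| for a vertex set X: number of rows it meets
  rowsSpanned : (Vtx m n → Bool) → ℕ
  rowsSpanned X = countFin (λ r → anyFin (λ c → X (r , c)))

{-# OPTIONS --safe #-}
-- Every vertex v has |madj⁺(v)| ≤ tw(G⁺) = tw(G) ≤ 2n + 1: {v} ∪ madj⁺(v) is a clique of the
-- filled graph, so by the Helly property of subtrees it lies in one bag of every tree decomposition,
-- and K₄ □ Kₙ has a path decomposition whose c-th bag holds two rows from column c on and the
-- other two rows up to column c.
--
-- Let X span rows a and b, and let Xᵥ be the part of X eliminated up to and including v. By the
-- fill-path lemma, madj⁺(v) contains every later vertex adjacent to a vertex reached from v through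
-- earlier ones. While no column meets both rows inside Xᵥ, this gives v at least n + 2r monotone
-- neighbours, r the number of vertices of Xᵥ in the row of v; once some column does (the rows are
-- joined), all of Xᵥ is reached and v gets at least 2n + |Xᵥ| − 2d, d the number of columns meeting
-- both rows. Tracking |X ∩ α[1,p]|, the sum of |madj⁺| over it and its intersection with
-- 𝒱(α, n + 2) step by step adds these bounds up to the claim. A join after three or more vertices
-- would force 2n + 2 monotone neighbours, and X is joined by step j since it is connected.

module Submission where

open import Defs
open import Data.Nat using (ℕ; zero; suc; _+_; _*_; _∸_; _≤_; _<_; ⌈_/2⌉; ⌊_/2⌋; z≤n; s≤s; _≤ᵇ_; _≡ᵇ_)
import Data.Nat.Properties as ℕ
open import Data.Fin using (Fin; toℕ; zero; suc; fromℕ<; inject₁) renaming (_≟_ to _≟ᶠ_)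
import Data.Fin.Properties as Fin
open import Data.Bool using (Bool; true; false; T; _∧_; _∨_; not; if_then_else_)
open import Data.Bool.Properties using (T-∧; T-∨; T-≡; T-not-≡; ∧-identityʳ; ∧-zeroʳ)
open import Data.Unit using (tt)
open import Data.Empty using (⊥; ⊥-elim)
open import Data.Product using (_×_; _,_; ∃; Σ; proj₁; proj₂)
open import Data.Product.Properties using (≡-dec)
open import Data.Sum using (_⊎_; inj₁; inj₂; [_,_]′)
open import Relation.Nullary using (¬_; Dec; yes; no)
open import Relation.Nullary.Decidable using (⌊_⌋; T?; toWitness; fromWitness; toWitnessFalse)
open import Relation.Binary.PropositionalEquality
  using (_≡_; _≢_; refl; sym; trans; cong; cong₂; subst; subst₂; ≢-sym; module ≡-Reasoning)
open import Function.Bundles using (_⇔_; Inverse; Equivalence)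
open import Data.Nat.Tactic.RingSolver using (solve-∀)
open import Algebra.Properties.CommutativeSemigroup ℕ.+-commutativeSemigroup
  using (interchange; x∙yz≈y∙xz; xy∙z≈xz∙y)

T-∧ˡ : ∀ {x y} → T (x ∧ y) → T x
T-∧ˡ {x} h = proj₁ (Equivalence.to (T-∧ {x}) h)

T-∧ʳ : ∀ {x y} → T (x ∧ y) → T y
T-∧ʳ {x} h = proj₂ (Equivalence.to (T-∧ {x}) h)

T-∧⁺ : ∀ {x y} → T x → T y → T (x ∧ y)
T-∧⁺ hx hy = Equivalence.from T-∧ (hx , hy)

T-∨⁻ : ∀ {x y} → T (x ∨ y) → T x ⊎ T y
T-∨⁻ {x} = Equivalence.to (T-∨ {x})

T-∨ˡ : ∀ {x y} → T x → T (x ∨ y)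
T-∨ˡ h = Equivalence.from T-∨ (inj₁ h)

T-∨ʳ : ∀ {x y} → T y → T (x ∨ y)
T-∨ʳ {x} h = Equivalence.from (T-∨ {x}) (inj₂ h)

T⇒≡true : ∀ {x} → T x → x ≡ true
T⇒≡true = Equivalence.to T-≡

¬T⇒≡false : ∀ {x} → ¬ T x → x ≡ false
¬T⇒≡false {true} h = ⊥-elim (h tt)
¬T⇒≡false {false} _ = refl

T-not⁺ : ∀ {x} → ¬ T x → T (not x)
T-not⁺ h = Equivalence.from T-not-≡ (¬T⇒≡false h)

T-not⁻ : ∀ {x} → T (not x) → ¬ T x
T-not⁻ {true} ()
T-not⁻ {false} _ ()

T-ext : ∀ {x y} → (T x → T y) → (T y → T x) → x ≡ y
T-ext {true} {true} _ _ = refl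
T-ext {true} {false} f _ = ⊥-elim (f tt)
T-ext {false} {true} _ g = ⊥-elim (g tt)
T-ext {false} {false} _ _ = refl

if-true : ∀ {A : Set} {b} {x y : A} → T b → (if b then x else y) ≡ x
if-true {b = true} _ = refl

if-false : ∀ {A : Set} {b} {x y : A} → ¬ T b → (if b then x else y) ≡ y
if-false {b = true} h = ⊥-elim (h tt)
if-false {b = false} _ = refl

𝟙 : Bool → ℕ
𝟙 b = if b then 1 else 0

𝟙≤1 : ∀ b → 𝟙 b ≤ 1
𝟙≤1 true = s≤s z≤n
𝟙≤1 false = z≤n

𝟙-mono : ∀ {x y} → (T x → T y) → 𝟙 x ≤ 𝟙 y
𝟙-mono {true} {true} _ = ℕ.≤-refl
𝟙-mono {true} {false} h = ⊥-elim (h tt)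
𝟙-mono {false} _ = z≤n

sumFin-cong : ∀ {k} {f g : Fin k → ℕ} → (∀ i → f i ≡ g i) → sumFin f ≡ sumFin g
sumFin-cong {zero} _ = refl
sumFin-cong {suc k} h = cong₂ _+_ (h zero) (sumFin-cong (λ i → h (suc i)))

sumFin-mono : ∀ {k} {f g : Fin k → ℕ} → (∀ i → f i ≤ g i) → sumFin f ≤ sumFin g
sumFin-mono {zero} _ = z≤n
sumFin-mono {suc k} h = ℕ.+-mono-≤ (h zero) (sumFin-mono (λ i → h (suc i)))

sumFin-+ : ∀ {k} (f g : Fin k → ℕ) → sumFin (λ i → f i + g i) ≡ sumFin f + sumFin g
sumFin-+ {zero} f g = refl
sumFin-+ {suc k} f g = begin
  f zero + g zero + sumFin (λ i → f (suc i) + g (suc i))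
    ≡⟨ cong (f zero + g zero +_) (sumFin-+ (λ i → f (suc i)) (λ i → g (suc i))) ⟩
  f zero + g zero + (sumFin (λ i → f (suc i)) + sumFin (λ i → g (suc i)))
    ≡⟨ interchange (f zero) (g zero) _ _ ⟩
  f zero + sumFin (λ i → f (suc i)) + (g zero + sumFin (λ i → g (suc i))) ∎
  where open ≡-Reasoning

sumFin-* : ∀ {k} c (f : Fin k → ℕ) → sumFin (λ i → c * f i) ≡ c * sumFin f
sumFin-* {zero} c f = sym (ℕ.*-zeroʳ c)
sumFin-* {suc k} c f =
  trans (cong (c * f zero +_) (sumFin-* c (λ i → f (suc i)))) (sym (ℕ.*-distribˡ-+ c (f zero) _))

sumFin-const : ∀ k c → sumFin {k} (λ _ → c) ≡ k * c
sumFin-const zero c = refl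
sumFin-const (suc k) c = cong (c +_) (sumFin-const k c)

sumFin-zero : ∀ {k} {f : Fin k → ℕ} → (∀ i → f i ≡ 0) → sumFin f ≡ 0
sumFin-zero {k} h = trans (sumFin-cong h) (trans (sumFin-const k 0) (ℕ.*-zeroʳ k))

sumFin-swap : ∀ {k l} (h : Fin k → Fin l → ℕ) →
  sumFin (λ r → sumFin (λ c → h r c)) ≡ sumFin (λ c → sumFin (λ r → h r c))
sumFin-swap {zero} {l} h = sym (sumFin-zero {l} (λ _ → refl))
sumFin-swap {suc k} h =
  trans (cong (sumFin (h zero) +_) (sumFin-swap (λ r c → h (suc r) c)))
        (sym (sumFin-+ (h zero) (λ c → sumFin (λ r → h (suc r) c))))

sumFin-≥-term : ∀ {k} (f : Fin k → ℕ) (i : Fin k) → f i ≤ sumFin f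
sumFin-≥-term f zero = ℕ.m≤m+n _ _
sumFin-≥-term f (suc i) = ℕ.≤-trans (sumFin-≥-term (λ i → f (suc i)) i) (ℕ.m≤n+m _ _)

erase : ∀ {k} → Fin k → (Fin k → ℕ) → Fin k → ℕ
erase zero f zero = 0
erase zero f (suc i) = f (suc i)
erase (suc i₀) f zero = f zero
erase (suc i₀) f (suc i) = erase i₀ (λ i → f (suc i)) i

erase-≢ : ∀ {k} {i₀ i : Fin k} (f : Fin k → ℕ) → i ≢ i₀ → erase i₀ f i ≡ f i
erase-≢ {i₀ = zero} {zero} f ne = ⊥-elim (ne refl)
erase-≢ {i₀ = zero} {suc i} f ne = refl
erase-≢ {i₀ = suc i₀} {zero} f ne = refl
erase-≢ {i₀ = suc i₀} {suc i} f ne = erase-≢ (λ i → f (suc i)) (λ e → ne (cong suc e))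

erase-≡ : ∀ {k} (i₀ : Fin k) (f : Fin k → ℕ) → erase i₀ f i₀ ≡ 0
erase-≡ zero f = refl
erase-≡ (suc i₀) f = erase-≡ i₀ (λ i → f (suc i))

sumFin-erase : ∀ {k} (i₀ : Fin k) (f : Fin k → ℕ) → sumFin f ≡ f i₀ + sumFin (erase i₀ f)
sumFin-erase zero f = refl
sumFin-erase (suc i₀) f = begin
  f zero + sumFin (λ i → f (suc i))
    ≡⟨ cong (f zero +_) (sumFin-erase i₀ (λ i → f (suc i))) ⟩
  f zero + (f (suc i₀) + sumFin (erase i₀ (λ i → f (suc i))))
    ≡⟨ x∙yz≈y∙xz (f zero) (f (suc i₀)) _ ⟩
  f (suc i₀) + (f zero + sumFin (erase i₀ (λ i → f (suc i)))) ∎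
  where open ≡-Reasoning

sumFin-≥-pair : ∀ {k} (f : Fin k → ℕ) {i j : Fin k} → i ≢ j → f i + f j ≤ sumFin f
sumFin-≥-pair f {i} {j} ne = begin
  f i + f j                 ≡⟨ cong (f i +_) (sym (erase-≢ f (λ e → ne (sym e)))) ⟩
  f i + erase i f j         ≤⟨ ℕ.+-monoʳ-≤ (f i) (sumFin-≥-term (erase i f) j) ⟩
  f i + sumFin (erase i f)  ≡⟨ sym (sumFin-erase i f) ⟩
  sumFin f                  ∎
  where open ℕ.≤-Reasoning

sumFin-≥-triple : ∀ {k} (f : Fin k → ℕ) {i j l : Fin k} → i ≢ j → i ≢ l → j ≢ l →
  f i + (f j + f l) ≤ sumFin f
sumFin-≥-triple f {i} {j} {l} i≢j i≢l j≢l = begin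
  f i + (f j + f l)
    ≡⟨ cong (f i +_) (sym (cong₂ _+_ (erase-≢ f (≢-sym i≢j)) (erase-≢ f (≢-sym i≢l)))) ⟩
  f i + (erase i f j + erase i f l)  ≤⟨ ℕ.+-monoʳ-≤ (f i) (sumFin-≥-pair (erase i f) j≢l) ⟩
  f i + sumFin (erase i f)           ≡⟨ sym (sumFin-erase i f) ⟩
  sumFin f                           ∎
  where open ℕ.≤-Reasoning

sumFin-only : ∀ {k} (f : Fin k → ℕ) (i₀ : Fin k) → (∀ i → i ≢ i₀ → f i ≡ 0) → sumFin f ≡ f i₀
sumFin-only f i₀ h = trans (sumFin-erase i₀ f) (trans (cong (f i₀ +_) (sumFin-zero erased)) (ℕ.+-identityʳ _))
  where
  erased : ∀ i → erase i₀ f i ≡ 0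
  erased i with i ≟ᶠ i₀
  ... | yes refl = erase-≡ i₀ f
  ... | no ne = trans (erase-≢ f ne) (h i ne)

sumFin-only₂ : ∀ {k} (f : Fin k → ℕ) {i₀ i₁ : Fin k} → i₀ ≢ i₁ →
  (∀ i → i ≢ i₀ → i ≢ i₁ → f i ≡ 0) → sumFin f ≡ f i₀ + f i₁
sumFin-only₂ f {i₀} {i₁} ne h =
  trans (sumFin-erase i₀ f) (cong (f i₀ +_) (trans (sumFin-only (erase i₀ f) i₁ erased) (erase-≢ f (≢-sym ne))))
  where
  erased : ∀ i → i ≢ i₁ → erase i₀ f i ≡ 0
  erased i ne₁ with i ≟ᶠ i₀
  ... | yes refl = erase-≡ i₀ f
  ... | no ne₀ = trans (erase-≢ f ne₀) (h i ne₀ ne₁)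

sumFin-≤-except : ∀ {k} (f g : Fin k → ℕ) (i₀ : Fin k) d →
  (∀ i → i ≢ i₀ → f i ≤ g i) → f i₀ ≤ g i₀ + d → sumFin f ≤ sumFin g + d
sumFin-≤-except f g i₀ d h h₀ = begin
  sumFin f                            ≡⟨ sumFin-erase i₀ f ⟩
  f i₀ + sumFin (erase i₀ f)          ≤⟨ ℕ.+-mono-≤ h₀ (sumFin-mono erased) ⟩
  g i₀ + d + sumFin (erase i₀ g)      ≡⟨ xy∙z≈xz∙y (g i₀) d _ ⟩
  g i₀ + sumFin (erase i₀ g) + d      ≡⟨ cong (_+ d) (sym (sumFin-erase i₀ g)) ⟩
  sumFin g + d                        ∎
  where
  open ℕ.≤-Reasoning
  erased : ∀ i → erase i₀ f i ≤ erase i₀ g i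
  erased i with i ≟ᶠ i₀
  ... | yes refl = ℕ.≤-reflexive (trans (erase-≡ i₀ f) (sym (erase-≡ i₀ g)))
  ... | no ne = subst₂ _≤_ (sym (erase-≢ f ne)) (sym (erase-≢ g ne)) (h i ne)

countFin-≤-sumFin : ∀ {k} (p : Fin k → Bool) (f : Fin k → ℕ) → (∀ i → T (p i) → 1 ≤ f i) →
  countFin p ≤ sumFin f
countFin-≤-sumFin p f h = sumFin-mono indicator≤
  where
  indicator≤ : ∀ i → 𝟙 (p i) ≤ f i
  indicator≤ i with T? (p i)
  ... | yes pi = subst (_≤ f i) (sym (if-true pi)) (h i pi)
  ... | no ¬pi = subst (_≤ f i) (sym (if-false ¬pi)) z≤n

anyFin-intro : ∀ {k} (p : Fin k → Bool) (i : Fin k) → T (p i) → T (anyFin p)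
anyFin-intro p zero h = T-∨ˡ h
anyFin-intro p (suc i) h = T-∨ʳ {p zero} (anyFin-intro (λ i → p (suc i)) i h)

anyFin-elim : ∀ {k} (p : Fin k → Bool) → T (anyFin p) → ∃ λ i → T (p i)
anyFin-elim {suc k} p h with T-∨⁻ {p zero} h
... | inj₁ h₀ = zero , h₀
... | inj₂ h₁ with anyFin-elim (λ i → p (suc i)) h₁
... | i , hi = suc i , hi

module _ {m n : ℕ} where
  _≟V_ : (u w : Vtx m n) → Dec (u ≡ w)
  _≟V_ = ≡-dec _≟ᶠ_ _≟ᶠ_

  eqV-sound : ∀ (u w : Vtx m n) → T (eqV u w) → u ≡ w
  eqV-sound (r , c) (r' , c') h =
    cong₂ _,_ (toWitness (T-∧ˡ {⌊ r ≟ᶠ r' ⌋} h)) (toWitness (T-∧ʳ {⌊ r ≟ᶠ r' ⌋} h))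

  eqV-refl : ∀ (u : Vtx m n) → T (eqV u u)
  eqV-refl (r , c) = T-∧⁺ (fromWitness {a? = r ≟ᶠ r} refl) (fromWitness {a? = c ≟ᶠ c} refl)

  sumV-cong : {f g : Vtx m n → ℕ} → (∀ v → f v ≡ g v) → sumV f ≡ sumV g
  sumV-cong h = sumFin-cong (λ r → sumFin-cong (λ c → h (r , c)))

  sumV-mono : {f g : Vtx m n → ℕ} → (∀ v → f v ≤ g v) → sumV f ≤ sumV g
  sumV-mono h = sumFin-mono (λ r → sumFin-mono (λ c → h (r , c)))

  sumV-+ : (f g : Vtx m n → ℕ) → sumV (λ v → f v + g v) ≡ sumV f + sumV g
  sumV-+ f g = trans (sumFin-cong (λ r → sumFin-+ (λ c → f (r , c)) (λ c → g (r , c))))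
                     (sumFin-+ {m} (λ r → sumFin (λ c → f (r , c))) (λ r → sumFin (λ c → g (r , c))))

  sumV-zero : {f : Vtx m n → ℕ} → (∀ v → f v ≡ 0) → sumV f ≡ 0
  sumV-zero h = sumFin-zero (λ r → sumFin-zero (λ c → h (r , c)))

  sumV-≥-term : (f : Vtx m n → ℕ) (u : Vtx m n) → f u ≤ sumV f
  sumV-≥-term f (r , c) =
    ℕ.≤-trans (sumFin-≥-term (λ c → f (r , c)) c) (sumFin-≥-term (λ r → sumFin (λ c → f (r , c))) r)

  sumV-≥-pair : (f : Vtx m n → ℕ) {u w : Vtx m n} → u ≢ w → f u + f w ≤ sumV f
  sumV-≥-pair f {r , c} {r' , c'} ne with r ≟ᶠ r'
  ... | yes refl = ℕ.≤-trans (sumFin-≥-pair (λ c → f (r , c)) (λ e → ne (cong (r ,_) e)))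
                             (sumFin-≥-term (λ r → sumFin (λ c → f (r , c))) r)
  ... | no r≢r' = ℕ.≤-trans (ℕ.+-mono-≤ (sumFin-≥-term (λ c → f (r , c)) c)
                                         (sumFin-≥-term (λ c → f (r' , c)) c'))
                            (sumFin-≥-pair (λ r → sumFin (λ c → f (r , c))) r≢r')

  sumV-only : (f : Vtx m n → ℕ) (u : Vtx m n) → (∀ v → v ≢ u → f v ≡ 0) → sumV f ≡ f u
  sumV-only f (r₀ , c₀) h =
    trans (sumFin-only _ r₀ (λ r ne → sumFin-zero (λ c → h (r , c) (λ e → ne (cong proj₁ e)))))
          (sumFin-only _ c₀ (λ c ne → h (r₀ , c) (λ e → ne (cong proj₂ e))))

  sumV-update : (f g : Vtx m n → ℕ) (v : Vtx m n) (d : ℕ) →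
    (∀ w → w ≢ v → f w ≡ g w) → f v ≡ g v + d → sumV f ≡ sumV g + d
  sumV-update f g v d same at-v = begin
    sumV f                          ≡⟨ sumV-cong (λ w → sym (ℕ.m+[n∸m]≡n (g≤f w))) ⟩
    sumV (λ w → g w + (f w ∸ g w))  ≡⟨ sumV-+ g (λ w → f w ∸ g w) ⟩
    sumV g + sumV (λ w → f w ∸ g w) ≡⟨ cong (sumV g +_) (sumV-only _ v (λ w ne → ℕ.m≤n⇒m∸n≡0 (ℕ.≤-reflexive (same w ne)))) ⟩
    sumV g + (f v ∸ g v)            ≡⟨ cong (λ x → sumV g + (x ∸ g v)) at-v ⟩
    sumV g + (g v + d ∸ g v)        ≡⟨ cong (sumV g +_) (ℕ.m+n∸m≡n (g v) d) ⟩
    sumV g + d                      ∎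
    where
    open ≡-Reasoning
    g≤f : ∀ w → g w ≤ f w
    g≤f w with w ≟V v
    ... | yes refl = ℕ.≤-trans (ℕ.m≤m+n (g w) d) (ℕ.≤-reflexive (sym at-v))
    ... | no ne = ℕ.≤-reflexive (sym (same w ne))

  sumV-by-columns : (f : Vtx m n → ℕ) → sumV f ≡ sumFin (λ c → sumFin (λ r → f (r , c)))
  sumV-by-columns f = sumFin-swap (λ r c → f (r , c))

  anyV-intro : (p : Vtx m n → Bool) (v : Vtx m n) → T (p v) → T (anyV p)
  anyV-intro p (r , c) h = anyFin-intro _ r (anyFin-intro (λ c → p (r , c)) c h)

  anyV-elim : (p : Vtx m n → Bool) → T (anyV p) → ∃ λ v → T (p v)
  anyV-elim p h with anyFin-elim _ h
  ... | r , hr with anyFin-elim (λ c → p (r , c)) hr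
  ... | c , hc = (r , c) , hc

  countV-mono : {p q : Vtx m n → Bool} → (∀ v → T (p v) → T (q v)) → countV p ≤ countV q
  countV-mono h = sumV-mono (λ v → 𝟙-mono (h v))

  countV-≥-member : (p : Vtx m n → Bool) {v : Vtx m n} → T (p v) → 1 ≤ countV p
  countV-≥-member p {v} h = subst (_≤ countV p) (if-true h) (sumV-≥-term (λ v → 𝟙 (p v)) v)

  countV-≥-pair : (p : Vtx m n → Bool) {u w : Vtx m n} → T (p u) → T (p w) → u ≢ w → 2 ≤ countV p
  countV-≥-pair p pu pw ne = subst (_≤ countV p) (cong₂ _+_ (if-true pu) (if-true pw)) (sumV-≥-pair (λ v → 𝟙 (p v)) ne)

  countV-witness : (p : Vtx m n → Bool) → 1 ≤ countV p → ∃ λ v → T (p v)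
  countV-witness p h with T? (anyV p)
  ... | yes some = anyV-elim p some
  ... | no none = ⊥-elim (ℕ.<⇒≱ h (ℕ.≤-reflexive (sumV-zero (λ v → if-false (λ pv → none (anyV-intro p v pv))))))

module _ {m n : ℕ} where
  rook-row : ∀ (u w : Vtx m n) → proj₁ u ≡ proj₁ w → proj₂ u ≢ proj₂ w → T (rook m n u w)
  rook-row (r , c) (r' , c') e ne with r ≟ᶠ r' | c ≟ᶠ c'
  ... | yes _ | no _ = tt
  ... | yes _ | yes e' = ⊥-elim (ne e')
  ... | no ne' | _ = ⊥-elim (ne' e)

  rook-col : ∀ (u w : Vtx m n) → proj₁ u ≢ proj₁ w → proj₂ u ≡ proj₂ w → T (rook m n u w)
  rook-col (r , c) (r' , c') ne e with r ≟ᶠ r' | c ≟ᶠ c'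
  ... | no _ | yes _ = tt
  ... | no _ | no ne' = ⊥-elim (ne' e)
  ... | yes e' | _ = ⊥-elim (ne e')

  rook-cases : ∀ (u w : Vtx m n) → T (rook m n u w) →
    (proj₁ u ≡ proj₁ w × proj₂ u ≢ proj₂ w) ⊎ (proj₁ u ≢ proj₁ w × proj₂ u ≡ proj₂ w)
  rook-cases (r , c) (r' , c') h with r ≟ᶠ r' | c ≟ᶠ c'
  ... | yes e | no ne = inj₁ (e , ne)
  ... | no ne | yes e = inj₂ (ne , e)

  rook-irrefl : ∀ (u : Vtx m n) → ¬ T (rook m n u u)
  rook-irrefl u h with rook-cases u u h
  ... | inj₁ (_ , ne) = ne refl
  ... | inj₂ (ne , _) = ne refl

  rook-sym : ∀ (u w : Vtx m n) → T (rook m n u w) → T (rook m n w u)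
  rook-sym u w h with rook-cases u w h
  ... | inj₁ (e , ne) = rook-row w u (sym e) (≢-sym ne)
  ... | inj₂ (ne , e) = rook-col w u (≢-sym ne) (sym e)

module EliminationGame {m n : ℕ} (G : Graph m n) (α : Ordering m n)
  (G-irrefl : ∀ u → ¬ T (G u u)) (G-sym : ∀ u w → T (G u w) → T (G w u)) where
  open Elim G α

  pos-injective : ∀ {u w} → pos u ≡ pos w → u ≡ w
  pos-injective {u} {w} e = begin
    u                          ≡⟨ sym (Inverse.strictlyInverseˡ α u) ⟩
    ord (Inverse.from α u)     ≡⟨ cong ord (Fin.toℕ-injective e) ⟩
    ord (Inverse.from α w)     ≡⟨ Inverse.strictlyInverseˡ α w ⟩
    w                          ∎
    where open ≡-Reasoning

  pos-ord : ∀ p → pos (ord p) ≡ toℕ p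
  pos-ord p = cong toℕ (Inverse.strictlyInverseʳ α p)

  pos<N : ∀ u → pos u < N
  pos<N u = Fin.toℕ<n (Inverse.from α u)

  vertexAt : ∀ k → k < N → ∃ λ z → pos z ≡ k
  vertexAt k k<N = ord (fromℕ< k<N) , trans (pos-ord _) (Fin.toℕ-fromℕ< k<N)

  game-alive : ∀ k u w → T (game k u w) → k ≤ pos u × k ≤ pos w
  game-alive zero u w h = z≤n , z≤n
  game-alive (suc k) u w h =
    ℕ.≤ᵇ⇒≤ (suc k) (pos u) (T-∧ˡ h) ,
    ℕ.≤ᵇ⇒≤ (suc k) (pos w) (T-∧ˡ (T-∧ʳ {alive (suc k) u} h))

  FillStep : ℕ → Vtx m n → Vtx m n → Set
  FillStep k u w = ∃ λ x → pos x ≡ k × T (game k u x) × T (game k x w) × u ≢ w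

  game-suc⁻ : ∀ k u w → T (game (suc k) u w) → T (game k u w) ⊎ FillStep k u w
  game-suc⁻ k u w h with T-∨⁻ (T-∧ʳ {alive (suc k) w} (T-∧ʳ {alive (suc k) u} h))
  ... | inj₁ g = inj₁ g
  ... | inj₂ fill with anyV-elim _ fill
  ... | x , hx = inj₂ (x , ℕ.≡ᵇ⇒≡ (pos x) k (T-∧ˡ hx) , T-∧ˡ hx₁ , T-∧ˡ hx₂ ,
                       λ e → T-not⁻ (T-∧ʳ {game k x w} hx₂) (subst (λ y → T (eqV u y)) e (eqV-refl u)))
    where
    hx₁ = T-∧ʳ {pos x ≡ᵇ k} hx
    hx₂ = T-∧ʳ {game k u x} hx₁

  game-suc⁺ : ∀ k u w → suc k ≤ pos u → suc k ≤ pos w →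
    T (game k u w) ⊎ FillStep k u w → T (game (suc k) u w)
  game-suc⁺ k u w hu hw g = T-∧⁺ (ℕ.≤⇒≤ᵇ hu) (T-∧⁺ (ℕ.≤⇒≤ᵇ hw) (kept-or-filled g))
    where
    kept-or-filled : T (game k u w) ⊎ FillStep k u w →
      T (game k u w ∨ anyV (λ x → (pos x ≡ᵇ k) ∧ game k u x ∧ game k x w ∧ not (eqV u w)))
    kept-or-filled (inj₁ g) = T-∨ˡ g
    kept-or-filled (inj₂ (x , e , g₁ , g₂ , ne)) = T-∨ʳ {game k u w} (anyV-intro _ x
       (T-∧⁺ (ℕ.≡⇒≡ᵇ (pos x) k e) (T-∧⁺ g₁ (T-∧⁺ g₂ (T-not⁺ (λ h → ne (eqV-sound u w h)))))))

  game-irrefl : ∀ k u → ¬ T (game k u u)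
  game-irrefl zero u h = G-irrefl u h
  game-irrefl (suc k) u h with game-suc⁻ k u u h
  ... | inj₁ g = game-irrefl k u g
  ... | inj₂ (_ , _ , _ , _ , ne) = ne refl

  game-sym : ∀ k u w → T (game k u w) → T (game k w u)
  game-sym zero u w h = G-sym u w h
  game-sym (suc k) u w h with game-alive (suc k) u w h | game-suc⁻ k u w h
  ... | au , aw | inj₁ g = game-suc⁺ k w u aw au (inj₁ (game-sym k u w g))
  ... | au , aw | inj₂ (x , e , g₁ , g₂ , ne) =
        game-suc⁺ k w u aw au (inj₂ (x , e , game-sym k x w g₂ , game-sym k u x g₁ , ≢-sym ne))

  data FillPath (k : ℕ) : Vtx m n → Vtx m n → Set where
    edge : ∀ {u w} → T (G u w) → FillPath k u w
    step : ∀ {u x w} → FillPath k u x → pos x < k → T (G x w) → FillPath k u w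

  private
    below : ∀ {k x z} → pos z ≡ k → pos x < suc k → x ≢ z → pos x < k
    below ez lt ne = ℕ.≤∧≢⇒< (ℕ.≤-pred lt) (λ e → ne (pos-injective (trans e (sym ez))))

    split-at : ∀ {k u w} (z : Vtx m n) → pos z ≡ k → FillPath (suc k) u w →
      FillPath k u w ⊎ (FillPath k u z × FillPath k z w)
    split-at z ez (edge e) = inj₁ (edge e)
    split-at z ez (step {x = x} p lt e) with x ≟V z | split-at z ez p
    ... | yes refl | inj₁ p′ = inj₂ (p′ , edge e)
    ... | yes refl | inj₂ (p₁ , _) = inj₂ (p₁ , edge e)
    ... | no ne | inj₁ p′ = inj₁ (step p′ (below ez lt ne) e)
    ... | no ne | inj₂ (p₁ , p₂) = inj₂ (p₁ , step p₂ (below ez lt ne) e)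

  -- The fill-path lemma of Rose, Tarjan and Lueker.
  fillPath⇒game : ∀ k u w → k ≤ pos u → k ≤ pos w → u ≢ w → FillPath k u w → T (game k u w)
  fillPath⇒game zero u w _ _ _ (edge e) = e
  fillPath⇒game (suc k) u w hu hw ne p with vertexAt k (ℕ.<-≤-trans hu (ℕ.<⇒≤ (pos<N u)))
  ... | z , ez with split-at z ez p
  ... | inj₁ p' = game-suc⁺ k u w hu hw (inj₁ (fillPath⇒game k u w (ℕ.<⇒≤ hu) (ℕ.<⇒≤ hw) ne p'))
  ... | inj₂ (p₁ , p₂) = game-suc⁺ k u w hu hw (inj₂ (z , ez ,
          fillPath⇒game k u z (ℕ.<⇒≤ hu) (ℕ.≤-reflexive (sym ez))
            (λ e → ℕ.<⇒≢ hu (trans (sym ez) (cong pos (sym e)))) p₁ ,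
          fillPath⇒game k z w (ℕ.≤-reflexive (sym ez)) (ℕ.<⇒≤ hw)
            (λ e → ℕ.<⇒≢ hw (trans (sym ez) (cong pos e))) p₂ ,
          ne))

  game⇒G-if-neighbours-alive : ∀ k v w → (∀ x → T (G v x) → k ≤ pos x) → T (game k v w) → T (G v w)
  game⇒G-if-neighbours-alive zero v w _ h = h
  game⇒G-if-neighbours-alive (suc k) v w later h with game-suc⁻ k v w h
  ... | inj₁ g = game⇒G-if-neighbours-alive k v w (λ x e → ℕ.<⇒≤ (later x e)) g
  ... | inj₂ (x , ex , g₁ , _ , _) =
    ⊥-elim (ℕ.<⇒≢ (later x (game⇒G-if-neighbours-alive k v x (λ y e → ℕ.<⇒≤ (later y e)) g₁)) (sym ex))

  game⇒filled : ∀ k u w → k ≤ N → T (game k u w) → T (filled u w)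
  game⇒filled k u w k≤N h = anyFin-intro (λ i → game (toℕ i) u w) (fromℕ< (s≤s k≤N))
     (subst (λ i → T (game i u w)) (sym (Fin.toℕ-fromℕ< (s≤s k≤N))) h)

  madj-later : ∀ v x → T (madj v x) → pos v < pos x
  madj-later v x h = ℕ.≤∧≢⇒< (proj₂ (game-alive (pos v) v x h))
     (λ e → game-irrefl (pos v) v (subst (λ y → T (game (pos v) v y)) (sym (pos-injective e)) h))

module TreeWalks {t : ℕ} (par : Fin t → Fin (suc t)) where
  treeWalk-end : ∀ {S a b} → TreeWalk par S a b → T (S b)
  treeWalk-end (here s) = s
  treeWalk-end (step _ _ s) = s

  treeWalk-map : ∀ {S S' a b} → (∀ c → T (S c) → T (S' c)) → TreeWalk par S a b → TreeWalk par S' a b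
  treeWalk-map f (here s) = here (f _ s)
  treeWalk-map f (step w e s) = step (treeWalk-map f w) e (f _ s)

  treeAdj-sym : ∀ {a b} → TreeAdj par a b → TreeAdj par b a
  treeAdj-sym (up i) = down i
  treeAdj-sym (down i) = up i

  treeWalk-cons : ∀ {S x a b} → TreeAdj par x a → T (S x) → TreeWalk par S a b → TreeWalk par S x b
  treeWalk-cons e s (here s') = step (here s) e s'
  treeWalk-cons e s (step w e' s') = step (treeWalk-cons e s w) e' s'

  treeWalk-reverse : ∀ {S a b} → TreeWalk par S a b → TreeWalk par S b a
  treeWalk-reverse (here s) = here s
  treeWalk-reverse (step w e s) = treeWalk-cons (treeAdj-sym e) s (treeWalk-reverse w)

-- Pruning the node of largest index one at a time: it is a leaf of the subtree on the nodes of
-- smaller index, since parents come first.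
module Helly {m n t : ℕ} (par : Fin t → Fin (suc t)) (par< : ∀ i → toℕ (par i) ≤ toℕ i)
             (bag : Fin (suc t) → Vtx m n → Bool) (K : Vtx m n → Bool) where
  open TreeWalks par

  live : ℕ → Fin (suc t) → Bool
  live L c = toℕ c ≤ᵇ L

  Sub : Vtx m n → ℕ → Fin (suc t) → Bool
  Sub v L c = bag c v ∧ live L c

  Connected : ℕ → Set
  Connected L = ∀ v → T (K v) → ∀ a b → T (Sub v L a) → T (Sub v L b) → TreeWalk par (Sub v L) a b

  PairwiseMeet : ℕ → Set
  PairwiseMeet L = ∀ v w → T (K v) → T (K w) → ∃ λ a → T (live L a) × T (bag a v) × T (bag a w)

  live⁻ : ∀ {L c} → T (live L c) → toℕ c ≤ L
  live⁻ {L} {c} h = ℕ.≤ᵇ⇒≤ (toℕ c) L h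

  live⁺ : ∀ {L c} → toℕ c ≤ L → T (live L c)
  live⁺ h = ℕ.≤⇒≤ᵇ h

  live-lower : ∀ {L c} → T (live (suc L) c) → toℕ c ≢ suc L → T (live L c)
  live-lower h ne = live⁺ (ℕ.≤-pred (ℕ.≤∧≢⇒< (live⁻ h) ne))

  top-neighbour : ∀ {L b c} → TreeAdj par b c → toℕ b ≡ suc L → toℕ c ≤ suc L →
    ∃ λ j → c ≡ par j × toℕ j ≡ L
  top-neighbour (up j) eb ec = j , refl , ℕ.suc-injective eb
  top-neighbour (down j) eb ec = ⊥-elim (ℕ.<⇒≱ (ℕ.≤-trans (ℕ.≤-reflexive (sym eb)) (par< j)) (ℕ.≤-pred ec))

  module _ (L : ℕ) (v : Vtx m n) where
    prune : ∀ {a c} → TreeWalk par (Sub v (suc L)) a c → T (live L a) →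
      (toℕ c ≢ suc L → TreeWalk par (Sub v L) a c) ×
      (toℕ c ≡ suc L → ∃ λ j → toℕ j ≡ L × TreeWalk par (Sub v L) a (par j))
    prune (here s) la = (λ _ → here (T-∧⁺ (T-∧ˡ s) la)) , (λ e → ⊥-elim (ℕ.<⇒≢ (s≤s (live⁻ la)) e))
    prune {a} {c} (step {b = b} w e s) la = to-low , to-top
      where
      low = proj₁ (prune w la)
      top = proj₂ (prune w la)
      to-low : toℕ c ≢ suc L → TreeWalk par (Sub v L) a c
      to-low ne with toℕ b ℕ.≟ suc L
      ... | yes eb with top eb | top-neighbour e eb (live⁻ (T-∧ʳ {bag c v} s))
      ... | j , ej , w' | j' , refl , ej' =
          subst (λ x → TreeWalk par (Sub v L) a (par x)) (Fin.toℕ-injective (trans ej (sym ej'))) w'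
      to-low ne | no nb = step (low nb) e (T-∧⁺ (T-∧ˡ s) (live-lower (T-∧ʳ {bag c v} s) ne))
      to-top : toℕ c ≡ suc L → ∃ λ j → toℕ j ≡ L × TreeWalk par (Sub v L) a (par j)
      to-top ec with top-neighbour (treeAdj-sym e) ec (live⁻ (T-∧ʳ {bag b v} (treeWalk-end w)))
      ... | j , refl , ej =
        j , ej , low (λ eb → ℕ.<⇒≱ (ℕ.≤-trans (ℕ.≤-reflexive (sym eb)) (par< j)) (ℕ.≤-reflexive ej))

  connected-lower : ∀ L → Connected (suc L) → Connected L
  connected-lower L conn v kv a b sa sb =
    proj₁ (prune L v (conn v kv a b (raise sa) (raise sb)) (T-∧ʳ {bag a v} sa))
          (λ e → ℕ.<⇒≢ (s≤s (live⁻ (T-∧ʳ {bag b v} sb))) e)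
    where
    raise : ∀ {c} → T (Sub v L c) → T (Sub v (suc L) c)
    raise {c} s = T-∧⁺ {bag c v} (T-∧ˡ {bag c v} s)
                       (live⁺ {suc L} {c} (ℕ.m≤n⇒m≤1+n (live⁻ {L} {c} (T-∧ʳ {bag c v} s))))

  -- If u ∈ K misses the top node ℓ, every v ∈ K at ℓ meets u elsewhere,
  -- so the subtree of v leaves ℓ through its parent.
  module _ (L : ℕ) (hL : suc L ≤ t) (conn : Connected (suc L)) (meet : PairwiseMeet (suc L))
           (u : Vtx m n) (ku : T (K u)) where
    private
      i : Fin t
      i = fromℕ< hL
      ℓ : Fin (suc t)
      ℓ = suc i
      toℕ-i : toℕ i ≡ L
      toℕ-i = Fin.toℕ-fromℕ< hL

    module _ (¬bag-ℓ-u : ¬ T (bag ℓ u)) where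
      parent-contains : ∀ v → T (K v) → T (bag ℓ v) → T (bag (par i) v)
      parent-contains v kv bl with meet v u kv ku
      ... | b , lb , bv , bu with conn v kv b ℓ (T-∧⁺ bv lb) (T-∧⁺ bl (live⁺ (ℕ.≤-reflexive (cong suc toℕ-i))))
      ... | here _ = ⊥-elim (¬bag-ℓ-u bu)
      ... | step {b = c} w e s with top-neighbour (treeAdj-sym e) (cong suc toℕ-i) (live⁻ (T-∧ʳ {bag c v} (treeWalk-end w)))
      ... | j , refl , ej =
        subst (λ x → T (bag (par x) v)) (Fin.toℕ-injective (trans ej (sym toℕ-i))) (T-∧ˡ (treeWalk-end w))

      pairwiseMeet-lower : PairwiseMeet L
      pairwiseMeet-lower v w kv kw with meet v w kv kw
      ... | a , la , bv , bw with toℕ a ℕ.≟ suc L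
      ... | no ne = a , live-lower la ne , bv , bw
      ... | yes e = par i , live⁺ (ℕ.≤-trans (par< i) (ℕ.≤-reflexive toℕ-i)) ,
                    parent-contains v kv (subst (λ x → T (bag x v)) a≡ℓ bv) ,
                    parent-contains w kw (subst (λ x → T (bag x w)) a≡ℓ bw)
        where
        a≡ℓ : a ≡ ℓ
        a≡ℓ = Fin.toℕ-injective (trans e (cong suc (sym toℕ-i)))

  helly : ∀ L → L ≤ t → Connected L → PairwiseMeet L → ∃ λ a → ∀ v → T (K v) → T (bag a v)
  helly zero _ conn meet = zero , at-root
    where
    at-root : ∀ v → T (K v) → T (bag zero v)
    at-root v kv with meet v v kv kv
    ... | a , la , ba , _ = subst (λ x → T (bag x v)) (Fin.toℕ-injective {j = zero} (ℕ.n≤0⇒n≡0 (live⁻ la))) ba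
  helly (suc L) hL conn meet with T? (anyV (λ v → K v ∧ not (bag (suc (fromℕ< hL)) v)))
  ... | no none = suc (fromℕ< hL) , all-in
    where
    all-in : ∀ v → T (K v) → T (bag (suc (fromℕ< hL)) v)
    all-in v kv with T? (bag (suc (fromℕ< hL)) v)
    ... | yes b = b
    ... | no nb = ⊥-elim (none (anyV-intro _ v (T-∧⁺ kv (T-not⁺ nb))))
  ... | yes some with anyV-elim _ some
  ... | u , hu = helly L (ℕ.<⇒≤ hL) (connected-lower L conn)
                   (pairwiseMeet-lower L hL conn meet u (T-∧ˡ hu) (T-not⁻ (T-∧ʳ {K u} hu)))

module MonotoneAdjacencyBound {m n : ℕ} (G : Graph m n) (α : Ordering m n)
  (G-irrefl : ∀ u → ¬ T (G u u)) (G-sym : ∀ u w → T (G u w) → T (G w u)) where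
  open Elim G α
  open EliminationGame G α G-irrefl G-sym

  closedMadj : Vtx m n → Vtx m n → Bool
  closedMadj v x = eqV x v ∨ madj v x

  closedMadj-clique : ∀ v x y → T (closedMadj v x) → T (closedMadj v y) → x ≢ y →
    T (filled x y) ⊎ T (filled y x)
  closedMadj-clique v x y kx ky ne with T-∨⁻ {eqV x v} kx | T-∨⁻ {eqV y v} ky
  ... | inj₁ ex | inj₁ ey = ⊥-elim (ne (trans (eqV-sound x v ex) (sym (eqV-sound y v ey))))
  ... | inj₁ ex | inj₂ my with eqV-sound x v ex
  ... | refl = inj₁ (game⇒filled (pos x) x y (ℕ.<⇒≤ (pos<N x)) my)
  closedMadj-clique v x y kx ky ne | inj₂ mx | inj₁ ey with eqV-sound y v ey
  ... | refl = inj₂ (game⇒filled (pos y) y x (ℕ.<⇒≤ (pos<N y)) mx)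
  closedMadj-clique v x y kx ky ne | inj₂ mx | inj₂ my =
    inj₁ (game⇒filled (suc (pos v)) x y (pos<N v)
      (game-suc⁺ (pos v) x y (madj-later v x mx) (madj-later v y my)
         (inj₂ (v , refl , game-sym (pos v) v x mx , my , ne))))

  closedMadj-size : ∀ v → suc (madjSize v) ≡ countV (closedMadj v)
  closedMadj-size v = begin
    1 + madjSize v                                    ≡⟨ cong (_+ madjSize v) (sym one) ⟩
    countV (λ x → eqV x v) + madjSize v               ≡⟨ sym (sumV-+ (λ x → 𝟙 (eqV x v)) (λ x → 𝟙 (madj v x))) ⟩
    sumV (λ x → 𝟙 (eqV x v) + 𝟙 (madj v x))           ≡⟨ sumV-cong disjoint ⟩
    countV (closedMadj v)                             ∎
    where
    open ≡-Reasoning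
    one : countV (λ x → eqV x v) ≡ 1
    one = trans (sumV-only (λ x → 𝟙 (eqV x v)) v (λ x ne → if-false (λ h → ne (eqV-sound x v h))))
                (if-true (eqV-refl v))
    disjoint : ∀ x → 𝟙 (eqV x v) + 𝟙 (madj v x) ≡ 𝟙 (eqV x v ∨ madj v x)
    disjoint x with x ≟V v
    ... | yes refl rewrite T⇒≡true (eqV-refl x) | ¬T⇒≡false (game-irrefl (pos x) x) = refl
    ... | no ne rewrite ¬T⇒≡false (λ h → ne (eqV-sound x v h)) = refl

  madjSize≤treewidth : ∀ w → Treewidth filled w → ∀ v → madjSize v ≤ w
  madjSize≤treewidth w ((D , width≤w) , _) v with H.helly t ℕ.≤-refl connected meet
    where
    open TreeDecomposition D
    module H = Helly par par< bag (closedMadj v)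
    everywhere-live : ∀ c → T (H.live t c)
    everywhere-live c = H.live⁺ {t} {c} (Fin.toℕ≤pred[n] c)
    connected : H.Connected t
    connected x _ a b sa sb = TreeWalks.treeWalk-map par (λ c s → T-∧⁺ s (everywhere-live c))
                                (subtree x a b (T-∧ˡ sa) (T-∧ˡ {bag b x} sb))
    meet : H.PairwiseMeet t
    meet x y kx ky with x ≟V y
    ... | yes refl with covV x
    ... | a , h = a , everywhere-live a , h , h
    meet x y kx ky | no ne with closedMadj-clique v x y kx ky ne
    ... | inj₁ f with covE x y f
    ... | a , hx , hy = a , everywhere-live a , hx , hy
    meet x y kx ky | no ne | inj₂ f with covE y x f
    ... | a , hy , hx = a , everywhere-live a , hx , hy
  ... | a , in-bag = ℕ.≤-pred (begin
    suc (madjSize v)                          ≡⟨ closedMadj-size v ⟩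
    countV (closedMadj v)                     ≤⟨ countV-mono in-bag ⟩
    countV (TreeDecomposition.bag D a)        ≤⟨ width≤w a ⟩
    suc w                                     ∎)
    where open ℕ.≤-Reasoning

-- A path decomposition of K₄ □ Kₙ of width 2n + 1

s≤ᵇs : ∀ a b → (suc a ≤ᵇ suc b) ≡ (a ≤ᵇ b)
s≤ᵇs zero b = refl
s≤ᵇs (suc a) b = refl

countFin-≥ : ∀ k K → countFin {k} (λ x → K ≤ᵇ toℕ x) ≡ k ∸ K
countFin-≥ zero K = sym (ℕ.0∸n≡0 K)
countFin-≥ (suc k) zero = cong suc (countFin-≥ k zero)
countFin-≥ (suc k) (suc K) = trans (sumFin-cong {k} (λ x → cong 𝟙 (s≤ᵇs K (toℕ x)))) (countFin-≥ k K)

countFin-≤ : ∀ k K → countFin {k} (λ x → toℕ x ≤ᵇ K) ≤ suc K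
countFin-≤ zero K = z≤n
countFin-≤ (suc k) zero = s≤s (ℕ.≤-reflexive (sumFin-zero {k} (λ _ → refl)))
countFin-≤ (suc k) (suc K) =
  s≤s (subst (_≤ suc K) (sumFin-cong {k} (λ x → cong 𝟙 (sym (s≤ᵇs (toℕ x) K)))) (countFin-≤ k K))

module RookPathDecomposition (n' : ℕ) where
  open TreeWalks {n'} inject₁

  private
    n : ℕ
    n = suc n'

  upperRows : Fin 4 → Bool
  upperRows zero = true
  upperRows (suc zero) = true
  upperRows _ = false

  bag : Fin n → Vtx 4 n → Bool
  bag c (r , x) = if upperRows r then (toℕ c ≤ᵇ toℕ x) else (toℕ x ≤ᵇ toℕ c)

  inject₁≤ : ∀ (i : Fin n') → toℕ (inject₁ i) ≤ toℕ i
  inject₁≤ i = ℕ.≤-reflexive (Fin.toℕ-inject₁ i)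

  ≤ᵇ-refl : ∀ k → T (k ≤ᵇ k)
  ≤ᵇ-refl k = ℕ.≤⇒≤ᵇ (ℕ.≤-refl {k})

  last : Fin n
  last = fromℕ< (ℕ.n<1+n n')

  ≤ᵇ-last : ∀ (x : Fin n) → T (toℕ x ≤ᵇ toℕ last)
  ≤ᵇ-last x rewrite Fin.toℕ-fromℕ< (ℕ.n<1+n n') = ℕ.≤⇒≤ᵇ (Fin.toℕ≤pred[n] x)

  walk-up : ∀ k (S : Fin n → Bool) (a b : Fin n) → toℕ b ≤ k → toℕ a ≤ toℕ b →
           (∀ c → toℕ a ≤ toℕ c → toℕ c ≤ toℕ b → T (S c)) → TreeWalk inject₁ S a b
  walk-up k S a b bk ab hS with toℕ a ℕ.≟ toℕ b
  ... | yes e = subst (TreeWalk inject₁ S a) (Fin.toℕ-injective e) (here (hS a ℕ.≤-refl ab))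
  walk-up k S a zero bk ab hS | no ne = ⊥-elim (ne (ℕ.n≤0⇒n≡0 ab))
  walk-up (suc k) S a (suc i) bk ab hS | no ne =
    step (walk-up k S a (inject₁ i) (ℕ.≤-trans (inject₁≤ i) (ℕ.≤-pred bk))
            (ℕ.≤-trans (ℕ.≤-pred (ℕ.≤∧≢⇒< ab ne)) (ℕ.≤-reflexive (sym (Fin.toℕ-inject₁ i))))
            (λ c h₁ h₂ → hS c h₁ (ℕ.≤-trans h₂ (ℕ.m≤n⇒m≤1+n (inject₁≤ i)))))
         (down i) (hS (suc i) ab ℕ.≤-refl)

  interval-walk : (S : Fin n → Bool) (a b : Fin n) → T (S a) → T (S b) →
    (∀ c c' c'' → toℕ c ≤ toℕ c' → toℕ c' ≤ toℕ c'' → T (S c) → T (S c'') → T (S c')) →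
    TreeWalk inject₁ S a b
  interval-walk S a b sa sb convex with ℕ.≤-total (toℕ a) (toℕ b)
  ... | inj₁ ab = walk-up (toℕ b) S a b ℕ.≤-refl ab (λ c h₁ h₂ → convex a c b h₁ h₂ sa sb)
  ... | inj₂ ba = treeWalk-reverse (walk-up (toℕ a) S b a ℕ.≤-refl ba (λ c h₁ h₂ → convex b c a h₁ h₂ sb sa))

  at-own-column : ∀ r x → T (bag x (r , x))
  at-own-column r x with upperRows r
  ... | true = ≤ᵇ-refl (toℕ x)
  ... | false = ≤ᵇ-refl (toℕ x)

  covers-vertex : ∀ v → ∃ λ a → T (bag a v)
  covers-vertex (r , x) = x , at-own-column r x

  covers-edge : ∀ u v → T (rook 4 n u v) → ∃ λ a → T (bag a u) × T (bag a v)
  covers-edge (r , x) (r' , x') h with rook-cases (r , x) (r' , x') h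
  ... | inj₂ (_ , refl) = x , at-own-column r x , at-own-column r' x
  ... | inj₁ (refl , _) with upperRows r
  ... | true = zero , tt , tt
  ... | false = last , ≤ᵇ-last x , ≤ᵇ-last x'

  subtree-connected : ∀ v a b → T (bag a v) → T (bag b v) → TreeWalk inject₁ (λ c → bag c v) a b
  subtree-connected (r , x) a b ha hb with upperRows r
  ... | true = interval-walk _ a b ha hb
       (λ c c' c'' h₁ h₂ s₁ s₂ → ℕ.≤⇒≤ᵇ (ℕ.≤-trans h₂ (ℕ.≤ᵇ⇒≤ (toℕ c'') (toℕ x) s₂)))
  ... | false = interval-walk _ a b ha hb
       (λ c c' c'' h₁ h₂ s₁ s₂ → ℕ.≤⇒≤ᵇ (ℕ.≤-trans (ℕ.≤ᵇ⇒≤ (toℕ x) (toℕ c) s₁) h₁))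

  decomposition : TreeDecomposition (rook 4 n)
  decomposition = record
    { t = n' ; par = inject₁ ; par< = inject₁≤ ; bag = bag
    ; covV = covers-vertex ; covE = covers-edge ; subtree = subtree-connected }

  bag-size : ∀ c → countV (bag c) ≤ suc (suc (2 * n))
  bag-size c = begin
    countV (bag c)                                ≡⟨⟩
    above + (above + (below + (below + 0)))      ≡⟨ double above below ⟩
    2 * (above + below)
      ≤⟨ ℕ.*-monoʳ-≤ 2 (ℕ.+-mono-≤ (ℕ.≤-reflexive (countFin-≥ n (toℕ c))) (countFin-≤ n (toℕ c))) ⟩
    2 * (n ∸ toℕ c + suc (toℕ c))
      ≡⟨ cong (2 *_) (trans (ℕ.+-suc _ (toℕ c)) (cong suc (ℕ.m∸n+n≡m (ℕ.<⇒≤ (Fin.toℕ<n c))))) ⟩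
    2 * suc n                                     ≡⟨ ℕ.*-suc 2 n ⟩
    suc (suc (2 * n))                             ∎
    where
    open ℕ.≤-Reasoning
    above below : ℕ
    above = countFin {n} (λ x → toℕ c ≤ᵇ toℕ x)
    below = countFin {n} (λ x → toℕ x ≤ᵇ toℕ c)
    double : ∀ a b → a + (a + (b + (b + 0))) ≡ 2 * (a + b)
    double = solve-∀

rook4-treewidth≤ : ∀ n' w → Treewidth (rook 4 (suc n')) w → w ≤ suc (2 * suc n')
rook4-treewidth≤ n' w (_ , every-decomposition-has-large-bag) with every-decomposition-has-large-bag D.decomposition
  where module D = RookPathDecomposition n'
... | a , large = ℕ.≤-pred (ℕ.≤-trans large (RookPathDecomposition.bag-size n' a))

count-≢ : ∀ (ρ : Fin 4) → countFin (λ r → not ⌊ r ≟ᶠ ρ ⌋) ≡ 3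
count-≢ zero = refl
count-≢ (suc zero) = refl
count-≢ (suc (suc zero)) = refl
count-≢ (suc (suc (suc zero))) = refl

count-≢₂ : ∀ (a b : Fin 4) → a ≢ b → countFin (λ r → not (⌊ r ≟ᶠ a ⌋ ∨ ⌊ r ≟ᶠ b ⌋)) ≡ 2
count-≢₂ zero zero ne = ⊥-elim (ne refl)
count-≢₂ zero (suc zero) _ = refl
count-≢₂ zero (suc (suc zero)) _ = refl
count-≢₂ zero (suc (suc (suc zero))) _ = refl
count-≢₂ (suc zero) zero _ = refl
count-≢₂ (suc zero) (suc zero) ne = ⊥-elim (ne refl)
count-≢₂ (suc zero) (suc (suc zero)) _ = refl
count-≢₂ (suc zero) (suc (suc (suc zero))) _ = refl
count-≢₂ (suc (suc zero)) zero _ = refl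
count-≢₂ (suc (suc zero)) (suc zero) _ = refl
count-≢₂ (suc (suc zero)) (suc (suc zero)) ne = ⊥-elim (ne refl)
count-≢₂ (suc (suc zero)) (suc (suc (suc zero))) _ = refl
count-≢₂ (suc (suc (suc zero))) zero _ = refl
count-≢₂ (suc (suc (suc zero))) (suc zero) _ = refl
count-≢₂ (suc (suc (suc zero))) (suc (suc zero)) _ = refl
count-≢₂ (suc (suc (suc zero))) (suc (suc (suc zero))) ne = ⊥-elim (ne refl)

sumFin₄-≥-except : ∀ ρ (g : Fin 4 → ℕ) → (∀ r → r ≢ ρ → 1 ≤ g r) → 3 ≤ sumFin g
sumFin₄-≥-except ρ g h = subst (_≤ sumFin g) (count-≢ ρ)
  (countFin-≤-sumFin (λ r → not ⌊ r ≟ᶠ ρ ⌋) g (λ r p → h r (toWitnessFalse p)))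

sumFin₄-≥-except₂ : ∀ a b (g : Fin 4 → ℕ) → a ≢ b → (∀ r → r ≢ a → r ≢ b → 1 ≤ g r) → 2 ≤ sumFin g
sumFin₄-≥-except₂ a b g ne h = subst (_≤ sumFin g) (count-≢₂ a b ne)
  (countFin-≤-sumFin (λ r → not (⌊ r ≟ᶠ a ⌋ ∨ ⌊ r ≟ᶠ b ⌋)) g (λ r p → h r (λ e → T-not⁻ p (T-∨ˡ (fromWitness {a? = r ≟ᶠ a} e)))
                                     (λ e → T-not⁻ p (T-∨ʳ {⌊ r ≟ᶠ a ⌋} (fromWitness {a? = r ≟ᶠ b} e)))))

sumFin₄-≤-except : ∀ ρ (g : Fin 4 → ℕ) → (∀ r → g r ≤ 1) → g ρ ≡ 0 → sumFin g ≤ 3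
sumFin₄-≤-except ρ g h₁ h₀ = subst (sumFin g ≤_) (count-≢ ρ) (sumFin-mono bound)
  where
  bound : ∀ r → g r ≤ 𝟙 (not ⌊ r ≟ᶠ ρ ⌋)
  bound r with r ≟ᶠ ρ
  ... | yes refl = ℕ.≤-reflexive h₀
  ... | no _ = h₁ r

rook-degree : ∀ {n} (v : Vtx 4 n) → countV (rook 4 n v) ≤ n + 2
rook-degree {n} v@(ρ , cv) = begin
  countV (rook 4 n v)                  ≡⟨ sumV-by-columns (λ w → 𝟙 (rook 4 n v w)) ⟩
  sumFin column                        ≤⟨ sumFin-≤-except column (λ _ → 1) cv 2 other-column own-column ⟩
  sumFin {n} (λ _ → 1) + 2             ≡⟨ cong (_+ 2) (trans (sumFin-const n 1) (ℕ.*-identityʳ n)) ⟩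
  n + 2                                ∎
  where
  open ℕ.≤-Reasoning
  column : Fin n → ℕ
  column x = sumFin (λ r → 𝟙 (rook 4 n v (r , x)))
  other-column : ∀ x → x ≢ cv → column x ≤ 1
  other-column x ne = ℕ.≤-trans (ℕ.≤-reflexive (sumFin-only _ ρ (λ r nr → if-false (not-adjacent r nr))))
                                (𝟙≤1 _)
    where
    not-adjacent : ∀ r → r ≢ ρ → ¬ T (rook 4 n v (r , x))
    not-adjacent r nr h with rook-cases v (r , x) h
    ... | inj₁ (e , _) = nr (sym e)
    ... | inj₂ (_ , e) = ne (sym e)
  own-column : column cv ≤ 1 + 2
  own-column = sumFin₄-≤-except ρ (λ r → 𝟙 (rook 4 n v (r , cv))) (λ r → 𝟙≤1 _) (if-false (rook-irrefl v))

⌈/2⌉-step : ∀ K D → 2 * D ≤ suc K → ⌈ suc K /2⌉ + 2 * D ≤ ⌈ K /2⌉ + suc K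
⌈/2⌉-step K D h with 2 * D ℕ.≟ suc K
... | no ne = ℕ.≤-trans (ℕ.+-mono-≤ (s≤s (ℕ.⌊n/2⌋-mono (ℕ.n≤1+n K))) (ℕ.≤-pred (ℕ.≤∧≢⇒< h ne)))
                        (ℕ.≤-reflexive (sym (ℕ.+-suc _ K)))
... | yes e = ℕ.≤-reflexive (begin
  ⌈ suc K /2⌉ + 2 * D     ≡⟨ cong (λ x → ⌈ x /2⌉ + 2 * D) (sym e) ⟩
  ⌈ 2 * D /2⌉ + 2 * D     ≡⟨ cong (_+ 2 * D) (trans (cong ⌈_/2⌉ D+D) (sym (ℕ.n≡⌈n+n/2⌉ D))) ⟩
  D + 2 * D               ≡⟨ cong₂ _+_ (sym ⌈K/2⌉≡D) e ⟩
  ⌈ K /2⌉ + suc K         ∎)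
  where
  open ≡-Reasoning
  D+D : 2 * D ≡ D + D
  D+D = cong (D +_) (ℕ.+-identityʳ D)
  ⌈K/2⌉≡D : ⌈ K /2⌉ ≡ D
  ⌈K/2⌉≡D = trans (cong ⌊_/2⌋ (trans (sym e) D+D)) (sym (ℕ.n≡⌊n+n/2⌋ D))

after-join-arith : ∀ n k S f D c → 2 * D ≤ suc (suc k) → 2 * n * k + ⌈ suc k /2⌉ + c ≤ S →
  2 * n + suc (suc k) ≤ f + 2 * D → 2 * n * suc k + ⌈ suc (suc k) /2⌉ + c ≤ S + f
after-join-arith n k S f D c hD hS hf = ℕ.+-cancelʳ-≤ (2 * D) _ _ (begin
  2 * n * suc k + ⌈ suc (suc k) /2⌉ + c + 2 * D
    ≡⟨ regroup₁ n k c ⌈ suc (suc k) /2⌉ (2 * D) ⟩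
  ⌈ suc (suc k) /2⌉ + 2 * D + (2 * n * k + c) + 2 * n
    ≤⟨ ℕ.+-monoˡ-≤ (2 * n) (ℕ.+-monoˡ-≤ (2 * n * k + c) (⌈/2⌉-step (suc k) D hD)) ⟩
  ⌈ suc k /2⌉ + suc (suc k) + (2 * n * k + c) + 2 * n
    ≡⟨ regroup₂ n k c ⌈ suc k /2⌉ ⟩
  2 * n * k + ⌈ suc k /2⌉ + c + (2 * n + suc (suc k))
    ≤⟨ ℕ.+-mono-≤ hS hf ⟩
  S + (f + 2 * D)
    ≡⟨ sym (ℕ.+-assoc S f (2 * D)) ⟩
  S + f + 2 * D ∎)
  where
  open ℕ.≤-Reasoning
  regroup₁ : ∀ n k c x d → 2 * n * suc k + x + c + d ≡ x + d + (2 * n * k + c) + 2 * n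
  regroup₁ = solve-∀
  regroup₂ : ∀ n k c x → x + suc (suc k) + (2 * n * k + c) + 2 * n ≡ 2 * n * k + x + c + (2 * n + suc (suc k))
  regroup₂ = solve-∀

join-madj-arith : ∀ n k f D → 2 * n + suc k ≤ f + 2 * D → D ≤ 1 → 2 * n + k ≤ suc f
join-madj-arith n k f D h D≤1 = ℕ.≤-pred (begin
  suc (2 * n + k)    ≡⟨ sym (ℕ.+-suc (2 * n) k) ⟩
  2 * n + suc k      ≤⟨ h ⟩
  f + 2 * D          ≤⟨ ℕ.+-monoʳ-≤ f (ℕ.*-monoʳ-≤ 2 D≤1) ⟩
  f + 2              ≡⟨ ℕ.+-comm f 2 ⟩
  suc (suc f)        ∎)
  where open ℕ.≤-Reasoning

join-single-arith : ∀ n S f → 4 ≤ n → n + 2 ≤ S → 2 * n ≤ f → 2 * n * 1 + 1 + 5 ≤ S + f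
join-single-arith n S f n≥4 hS hf = begin
  2 * n * 1 + 1 + 5    ≡⟨ regroup n ⟩
  4 + 2 + 2 * n        ≤⟨ ℕ.+-monoˡ-≤ (2 * n) (ℕ.+-monoˡ-≤ 2 n≥4) ⟩
  n + 2 + 2 * n        ≤⟨ ℕ.+-mono-≤ hS hf ⟩
  S + f                ∎
  where
  open ℕ.≤-Reasoning
  regroup : ∀ n → 2 * n * 1 + 1 + 5 ≡ 4 + 2 + 2 * n
  regroup = solve-∀

join-pair-arith : ∀ n S f c → 2 * n + suc c ≤ S → 2 * n + 1 ≤ f → 2 * n * 2 + 2 + c ≤ S + f
join-pair-arith n S f c hS hf = ℕ.≤-trans (ℕ.≤-reflexive (regroup n c)) (ℕ.+-mono-≤ hS hf)
  where
  regroup : ∀ n c → 2 * n * 2 + 2 + c ≡ 2 * n + suc c + (2 * n + 1)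
  regroup = solve-∀

pair-arith : ∀ n S f x y → n + x ≤ S → n + y ≤ f → 2 * n + (x + y) ≤ S + f
pair-arith n S f x y hS hf = ℕ.≤-trans (ℕ.≤-reflexive (regroup n x y)) (ℕ.+-mono-≤ hS hf)
  where
  regroup : ∀ n x y → 2 * n + (x + y) ≡ n + x + (n + y)
  regroup = solve-∀

-- A component spanning two rows

module TwoRowComponent {n : ℕ} (α : Ordering 4 n) (j : Fin (4 * n)) (X : Vtx 4 n → Bool)
  (X⇔comp : ∀ v → T (X v) ⇔ Elim.InComp (rook 4 n) α j v)
  (two-rows : Elim.rowsSpanned (rook 4 n) α X ≡ 2) where
  open Elim (rook 4 n) α
  open EliminationGame (rook 4 n) α rook-irrefl rook-sym

  G : Graph 4 n
  G = rook 4 n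

  X⇒pos≤j : ∀ {v} → T (X v) → pos v ≤ toℕ j
  X⇒pos≤j {v} h with Equivalence.to (X⇔comp v) h
  ... | here s = ℕ.≤ᵇ⇒≤ (pos v) (toℕ j) s
  ... | step _ _ s = ℕ.≤ᵇ⇒≤ (pos v) (toℕ j) s

  X-closed : ∀ {u z} → T (X u) → T (G u z) → pos z ≤ toℕ j → T (X z)
  X-closed {u} {z} h e le = Equivalence.from (X⇔comp z) (step (Equivalence.to (X⇔comp u) h) e (ℕ.≤⇒≤ᵇ le))

  meetsRow : Fin 4 → Bool
  meetsRow r = anyFin (λ c → X (r , c))

  X-meetsRow : ∀ {u} → T (X u) → T (meetsRow (proj₁ u))
  X-meetsRow {r , c} h = anyFin-intro (λ c → X (r , c)) c h

  a : Fin 4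
  a = proj₁ (ord j)

  X-ord-j : T (X (ord j))
  X-ord-j = Equivalence.from (X⇔comp (ord j)) (here (ℕ.≤⇒≤ᵇ (ℕ.≤-reflexive (pos-ord j))))

  second-row : Σ (Fin 4) λ b → b ≢ a × Σ (Fin n) λ c → T (X (b , c))
  second-row with T? (anyFin (λ r → not ⌊ r ≟ᶠ a ⌋ ∧ meetsRow r))
  ... | yes h with anyFin-elim (λ r → not ⌊ r ≟ᶠ a ⌋ ∧ meetsRow r) h
  ... | r , hr with anyFin-elim (λ c → X (r , c)) (T-∧ʳ {not ⌊ r ≟ᶠ a ⌋} hr)
  ... | c , hc = r , (λ e → T-not⁻ (T-∧ˡ {not ⌊ r ≟ᶠ a ⌋} hr) (fromWitness e)) , c , hc
  second-row | no none = ⊥-elim (ℕ.<-irrefl refl (begin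
    2                       ≡⟨ sym two-rows ⟩
    rowsSpanned X           ≡⟨ sumFin-only (λ r → 𝟙 (meetsRow r)) a only-a ⟩
    𝟙 (meetsRow a)          ≤⟨ 𝟙≤1 (meetsRow a) ⟩
    1                       ∎))
    where
    open ℕ.≤-Reasoning
    only-a : ∀ r → r ≢ a → 𝟙 (meetsRow r) ≡ 0
    only-a r ne = if-false {b = meetsRow r} (λ m → none (anyFin-intro (λ r → not ⌊ r ≟ᶠ a ⌋ ∧ meetsRow r) r
                    (T-∧⁺ {not ⌊ r ≟ᶠ a ⌋} (T-not⁺ {⌊ r ≟ᶠ a ⌋} (λ h → ne (toWitness h))) m)))

  b : Fin 4
  b = proj₁ second-row

  b≢a : b ≢ a
  b≢a = proj₁ (proj₂ second-row)

  X-in-b : T (X (b , proj₁ (proj₂ (proj₂ second-row))))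
  X-in-b = proj₂ (proj₂ (proj₂ second-row))

  X-rows : ∀ {u} → T (X u) → proj₁ u ≡ a ⊎ proj₁ u ≡ b
  X-rows {u} h with proj₁ u ≟ᶠ a | proj₁ u ≟ᶠ b
  ... | yes e | _ = inj₁ e
  ... | no _ | yes e = inj₂ e
  ... | no na | no nb = ⊥-elim (ℕ.<-irrefl refl (begin
    1 + (1 + 1)
      ≡⟨ sym (cong₂ _+_ (if-true (X-meetsRow X-ord-j))
                        (cong₂ _+_ (if-true (X-meetsRow X-in-b)) (if-true (X-meetsRow h)))) ⟩
    𝟙 (meetsRow a) + (𝟙 (meetsRow b) + 𝟙 (meetsRow (proj₁ u)))
      ≤⟨ sumFin-≥-triple (λ r → 𝟙 (meetsRow r)) (≢-sym b≢a) (≢-sym na) (≢-sym nb) ⟩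
    rowsSpanned X
      ≡⟨ two-rows ⟩
    2 ∎))
    where open ℕ.≤-Reasoning

  X-rows-≢ : ∀ {u w} → T (X u) → T (X w) → proj₁ u ≢ proj₁ w →
             (proj₁ u ≡ a × proj₁ w ≡ b) ⊎ (proj₁ u ≡ b × proj₁ w ≡ a)
  X-rows-≢ hu hw ne with X-rows hu | X-rows hw
  ... | inj₁ e₁ | inj₁ e₂ = ⊥-elim (ne (trans e₁ (sym e₂)))
  ... | inj₁ e₁ | inj₂ e₂ = inj₁ (e₁ , e₂)
  ... | inj₂ e₁ | inj₁ e₂ = inj₂ (e₁ , e₂)
  ... | inj₂ e₁ | inj₂ e₂ = ⊥-elim (ne (trans e₁ (sym e₂)))

  Xpre : ℕ → Vtx 4 n → Bool
  Xpre p w = X w ∧ prefix p w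

  Xpre⇒X : ∀ {p w} → T (Xpre p w) → T (X w)
  Xpre⇒X {p} {w} h = T-∧ˡ {X w} h

  Xpre⇒pos< : ∀ {p w} → T (Xpre p w) → pos w < p
  Xpre⇒pos< {p} {w} h = ℕ.≤ᵇ⇒≤ (suc (pos w)) p (T-∧ʳ {X w} h)

  Xpre-intro : ∀ {p w} → T (X w) → pos w < p → T (Xpre p w)
  Xpre-intro h lt = T-∧⁺ h (ℕ.≤⇒≤ᵇ lt)

  Xpre-suc : ∀ {p w} → T (Xpre p w) → T (Xpre (suc p) w)
  Xpre-suc {p} h = Xpre-intro (Xpre⇒X {p} h) (ℕ.m≤n⇒m≤1+n (Xpre⇒pos< {p} h))

  Xupto : Vtx 4 n → Vtx 4 n → Bool
  Xupto v = Xpre (suc (pos v))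

  Xupto⇒X : ∀ {v w} → T (Xupto v w) → T (X w)
  Xupto⇒X {v} {w} h = T-∧ˡ {X w} h

  Xupto⇒pos≤ : ∀ {v w} → T (Xupto v w) → pos w ≤ pos v
  Xupto⇒pos≤ {v} h = ℕ.≤-pred (Xpre⇒pos< {suc (pos v)} h)

  Xupto-intro : ∀ {v w} → T (X w) → pos w ≤ pos v → T (Xupto v w)
  Xupto-intro h le = Xpre-intro h (s≤s le)

  Reach : Vtx 4 n → Vtx 4 n → Set
  Reach v u = u ≡ v ⊎ (pos u < pos v × FillPath (pos v) v u)

  reach-extend : ∀ {v u z} → Reach v u → T (G u z) → FillPath (pos v) v z
  reach-extend (inj₁ refl) e = edge e
  reach-extend (inj₂ (lt , p)) e = step p lt e

  reach⇒madj : ∀ {v u z} → Reach v u → T (G u z) → pos v < pos z → T (madj v z)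
  reach⇒madj {v} r e lt =
    fillPath⇒game (pos v) v _ ℕ.≤-refl (ℕ.<⇒≤ lt) (λ eq → ℕ.<⇒≢ lt (cong pos eq)) (reach-extend r e)

  reach-step : ∀ {v u u'} → Reach v u → T (Xupto v u') → T (G u u') → Reach v u'
  reach-step {v} {u} {u'} r q e with u' ≟V v
  ... | yes eq = inj₁ eq
  ... | no ne = inj₂ (ℕ.≤∧≢⇒< (Xupto⇒pos≤ {v} q) (λ eq → ne (pos-injective eq)) , reach-extend r e)

  reach-same-row : ∀ {v u} → T (Xupto v u) → proj₁ u ≡ proj₁ v → Reach v u
  reach-same-row {v} {u} q er with u ≟V v
  ... | yes eq = inj₁ eq
  ... | no ne = reach-step (inj₁ refl) q (rook-row v u (sym er) (λ ec → ne (cong₂ _,_ er (sym ec))))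

  later-in-X : ∀ {v u z} → T (X v) → T (X u) → T (G u z) → ¬ T (Xupto v z) → pos v < pos z
  later-in-X {v} {u} {z} hv hu e nq with pos z ℕ.≤? pos v
  ... | yes le = ⊥-elim (nq (Xupto-intro (X-closed hu e (ℕ.≤-trans le (X⇒pos≤j hv))) le))
  ... | no nle = ℕ.≰⇒> nle

  later-outside-X : ∀ {v u z} → T (X v) → T (X u) → T (G u z) → ¬ T (X z) → pos v < pos z
  later-outside-X {v} {u} {z} hv hu e nx with pos z ℕ.≤? toℕ j
  ... | yes le = ⊥-elim (nx (X-closed hu e le))
  ... | no nle = ℕ.≤-<-trans (X⇒pos≤j hv) (ℕ.≰⇒> nle)

  madjColumn : Vtx 4 n → Fin n → ℕ
  madjColumn v x = sumFin (λ r → 𝟙 (madj v (r , x)))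

  madjSize-by-columns : ∀ v → madjSize v ≡ sumFin (madjColumn v)
  madjSize-by-columns v = sumV-by-columns (λ w → 𝟙 (madj v w))

  madj⇒1≤ : ∀ {v z} → T (madj v z) → 1 ≤ 𝟙 (madj v z)
  madj⇒1≤ h = ℕ.≤-reflexive (sym (if-true h))

  rowCount : Vtx 4 n → Fin 4 → ℕ
  rowCount v r = countFin (λ x → Xupto v (r , x))

  Joined : (Vtx 4 n → Bool) → Set
  Joined S = Σ (Fin n) λ y → T (S (a , y)) × T (S (b , y))

  -- A column carries 3 monotone neighbours of v if it meets the row of v within Xupto v, and 1 otherwise.
  madj-before-join : ∀ v → T (X v) → ¬ Joined (Xupto v) → n + 2 * rowCount v (proj₁ v) ≤ madjSize v
  madj-before-join (ρ , cv) hv unjoined = begin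
    n + 2 * rowCount v ρ                            ≡⟨ sym per-column-sum ⟩
    sumFin (λ x → 1 + 2 * 𝟙 (Xupto v (ρ , x)))      ≤⟨ sumFin-mono column ⟩
    sumFin (madjColumn v)                           ≡⟨ sym (madjSize-by-columns v) ⟩
    madjSize v                                      ∎
    where
    open ℕ.≤-Reasoning
    v : Vtx 4 n
    v = ρ , cv
    per-column-sum : sumFin (λ x → 1 + 2 * 𝟙 (Xupto v (ρ , x))) ≡ n + 2 * rowCount v ρ
    per-column-sum = trans (sumFin-+ (λ _ → 1) (λ x → 2 * 𝟙 (Xupto v (ρ , x))))
      (cong₂ _+_ (trans (sumFin-const n 1) (ℕ.*-identityʳ n)) (sumFin-* 2 (λ x → 𝟙 (Xupto v (ρ , x)))))
    column : ∀ x → 1 + 2 * 𝟙 (Xupto v (ρ , x)) ≤ madjColumn v x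
    column x with T? (Xupto v (ρ , x))
    ... | yes q rewrite if-true {x = 1} {y = 0} q = sumFin₄-≥-except ρ (λ r → 𝟙 (madj v (r , x))) other-rows
      where
      other-rows : ∀ r → r ≢ ρ → 1 ≤ 𝟙 (madj v (r , x))
      other-rows r ne = madj⇒1≤ (reach⇒madj (reach-same-row q refl) e (later-in-X hv (Xupto⇒X q) e not-yet))
        where
        e : T (G (ρ , x) (r , x))
        e = rook-col (ρ , x) (r , x) (≢-sym ne) refl
        not-yet : ¬ T (Xupto v (r , x))
        not-yet q' with X-rows-≢ (Xupto⇒X q) (Xupto⇒X q') (≢-sym ne)
        ... | inj₁ (refl , refl) = unjoined (x , q , q')
        ... | inj₂ (refl , refl) = unjoined (x , q' , q)
    ... | no nq rewrite if-false {x = 1} {y = 0} nq =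
      ℕ.≤-trans (madj⇒1≤ (reach⇒madj (inj₁ refl) e (later-in-X hv hv e nq)))
                (sumFin-≥-term (λ r → 𝟙 (madj v (r , x))) ρ)
      where
      e : T (G v (ρ , x))
      e = rook-row v (ρ , x) refl (λ ec → nq (subst (λ c → T (Xupto v (ρ , c))) ec (Xupto-intro hv ℕ.≤-refl)))

  doubledAt : Vtx 4 n → Fin n → ℕ
  doubledAt v x = 𝟙 (Xupto v (a , x) ∧ Xupto v (b , x))

  doubled : Vtx 4 n → ℕ
  doubled v = sumFin (doubledAt v)

  columnCount : Vtx 4 n → Fin n → ℕ
  columnCount v x = 𝟙 (Xupto v (a , x)) + 𝟙 (Xupto v (b , x))

  Xupto-by-columns : ∀ v → countV (Xupto v) ≡ sumFin (columnCount v)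
  Xupto-by-columns v = trans (sumV-by-columns (λ w → 𝟙 (Xupto v w)))
    (sumFin-cong (λ x → sumFin-only₂ (λ r → 𝟙 (Xupto v (r , x))) (≢-sym b≢a) (outside x)))
    where
    outside : ∀ x r → r ≢ a → r ≢ b → 𝟙 (Xupto v (r , x)) ≡ 0
    outside x r na nb = if-false λ q → [ na , nb ]′ (X-rows (Xupto⇒X q))

  2*doubled≤ : ∀ v → 2 * doubled v ≤ countV (Xupto v)
  2*doubled≤ v = begin
    2 * doubled v                      ≡⟨ sym (sumFin-* 2 (doubledAt v)) ⟩
    sumFin (λ x → 2 * doubledAt v x)   ≤⟨ sumFin-mono column ⟩
    sumFin (columnCount v)             ≡⟨ sym (Xupto-by-columns v) ⟩
    countV (Xupto v)                   ∎
    where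
    open ℕ.≤-Reasoning
    column : ∀ x → 2 * doubledAt v x ≤ columnCount v x
    column x with Xupto v (a , x) | Xupto v (b , x)
    ... | true | true = ℕ.≤-refl
    ... | true | false = z≤n
    ... | false | _ = z≤n

  joined-column : ∀ {v} ((y , qa , qb) : Joined (Xupto v)) {w} → T (X w) → T (Xupto v (proj₁ w , y))
  joined-column {v} (y , qa , qb) hw with X-rows hw
  ... | inj₁ e = subst (λ r → T (Xupto v (r , y))) (sym e) qa
  ... | inj₂ e = subst (λ r → T (Xupto v (r , y))) (sym e) qb

  reach-column : ∀ v → T (X v) → (J : Joined (Xupto v)) → ∀ {u} → T (Xupto v u) → Reach v (proj₁ u , proj₁ J)
  reach-column v hv J {u} q with proj₁ u ≟ᶠ proj₁ v
  ... | yes e = reach-same-row (joined-column J (Xupto⇒X q)) e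
  ... | no ne = reach-step (reach-same-row (joined-column J hv) refl) (joined-column J (Xupto⇒X q))
                           (rook-col _ _ (≢-sym ne) refl)

  reach-all : ∀ v → T (X v) → Joined (Xupto v) → ∀ u → T (Xupto v u) → Reach v u
  reach-all v hv J@(y , _) u q with u ≟V (proj₁ u , y)
  ... | yes refl = reach-column v hv J q
  ... | no nw = reach-step (reach-column v hv J q) q (rook-row _ u refl (λ e → nw (cong (proj₁ u ,_) (sym e))))

  module _ (v : Vtx 4 n) (hv : T (X v)) (J : Joined (Xupto v)) where
    private
      y = proj₁ J
      qa = proj₁ (proj₂ J)
      qb = proj₂ (proj₂ J)
      cell : Fin n → Fin 4 → ℕ
      cell x r = 𝟙 (madj v (r , x))

    madj-along-row : ∀ r x → T (Xupto v (r , y)) → ¬ T (Xupto v (r , x)) → 1 ≤ 𝟙 (madj v (r , x))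
    madj-along-row r x qy nq = madj⇒1≤ (reach⇒madj (reach-all v hv J (r , y) qy) e (later-in-X hv (Xupto⇒X qy) e nq))
      where
      e : T (G (r , y) (r , x))
      e = rook-row (r , y) (r , x) refl (λ eq → nq (subst (λ c → T (Xupto v (r , c))) eq qy))

    madj-along-column : ∀ r r' x → r ≢ a → r ≢ b → T (Xupto v (r' , x)) → 1 ≤ 𝟙 (madj v (r , x))
    madj-along-column r r' x na nb q =
      madj⇒1≤ (reach⇒madj (reach-all v hv J (r' , x) q) e (later-outside-X hv (Xupto⇒X q) e nx))
      where
      nx : ¬ T (X (r , x))
      nx h = [ na , nb ]′ (X-rows h)
      e : T (G (r' , x) (r , x))
      e = rook-col (r' , x) (r , x) (λ { refl → nx (Xupto⇒X q) }) refl

    -- A column with i vertices of Xupto v carries 2 + i monotone neighbours of v,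
    -- minus 2 if it meets both rows.
    madjColumn-after-join : ∀ x → 2 + columnCount v x ≤ madjColumn v x + 2 * doubledAt v x
    madjColumn-after-join x with T? (Xupto v (a , x)) | T? (Xupto v (b , x))
    ... | yes ta | yes tb rewrite if-true {x = 1} {y = 0} ta | if-true {x = 1} {y = 0} tb | T⇒≡true ta | T⇒≡true tb =
      ℕ.+-monoˡ-≤ 2 (sumFin₄-≥-except₂ a b (cell x) (≢-sym b≢a) (λ r na nb → madj-along-column r a x na nb ta))
    ... | yes ta | no nb rewrite if-true {x = 1} {y = 0} ta | if-false {x = 1} {y = 0} nb | T⇒≡true ta | ¬T⇒≡false nb =
      ℕ.≤-trans (sumFin₄-≥-except a (cell x) others) (ℕ.m≤m+n _ 0)
      where
      others : ∀ r → r ≢ a → 1 ≤ cell x r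
      others r na with r ≟ᶠ b
      ... | yes refl = madj-along-row b x qb nb
      ... | no nb' = madj-along-column r a x na nb' ta
    ... | no na | yes tb rewrite if-false {x = 1} {y = 0} na | if-true {x = 1} {y = 0} tb | ¬T⇒≡false na =
      ℕ.≤-trans (sumFin₄-≥-except b (cell x) others) (ℕ.m≤m+n _ 0)
      where
      others : ∀ r → r ≢ b → 1 ≤ cell x r
      others r nb with r ≟ᶠ a
      ... | yes refl = madj-along-row a x qa na
      ... | no na' = madj-along-column r b x na' nb tb
    ... | no na | no nb rewrite if-false {x = 1} {y = 0} na | if-false {x = 1} {y = 0} nb | ¬T⇒≡false na =
      ℕ.≤-trans (ℕ.≤-trans (ℕ.+-mono-≤ (madj-along-row a x qa na) (madj-along-row b x qb nb))
                           (sumFin-≥-pair (cell x) (≢-sym b≢a)))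
                (ℕ.m≤m+n _ 0)

    madj-after-join : 2 * n + countV (Xupto v) ≤ madjSize v + 2 * doubled v
    madj-after-join = begin
      2 * n + countV (Xupto v)
        ≡⟨ cong₂ _+_ (trans (ℕ.*-comm 2 n) (sym (sumFin-const n 2))) (Xupto-by-columns v) ⟩
      sumFin {n} (λ _ → 2) + sumFin (columnCount v)
        ≡⟨ sym (sumFin-+ (λ _ → 2) (columnCount v)) ⟩
      sumFin (λ x → 2 + columnCount v x)
        ≤⟨ sumFin-mono madjColumn-after-join ⟩
      sumFin (λ x → madjColumn v x + 2 * doubledAt v x)
        ≡⟨ sumFin-+ (madjColumn v) (λ x → 2 * doubledAt v x) ⟩
      sumFin (madjColumn v) + sumFin (λ x → 2 * doubledAt v x)
        ≡⟨ cong₂ _+_ (sym (madjSize-by-columns v)) (sumFin-* 2 (doubledAt v)) ⟩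
      madjSize v + 2 * doubled v ∎
      where open ℕ.≤-Reasoning

  madj≤n+2 : ∀ v → (∀ z → T (G v z) → pos v ≤ pos z) → madjSize v ≤ n + 2
  madj≤n+2 v later = ℕ.≤-trans (countV-mono (λ w → game⇒G-if-neighbours-alive (pos v) v w later)) (rook-degree v)

  Xpre-self : ∀ v → ¬ T (Xpre (pos v) v)
  Xpre-self v h = ℕ.<-irrefl refl (Xpre⇒pos< {pos v} h)

  Xupto-self : ∀ v → Xupto v v ≡ X v
  Xupto-self v = T-ext (Xupto⇒X {v}) (λ h → Xupto-intro h ℕ.≤-refl)

  Xupto-other : ∀ {v w} → w ≢ v → Xupto v w ≡ Xpre (pos v) w
  Xupto-other {v} {w} ne = T-ext earlier (Xpre-suc {pos v})
    where
    earlier : T (Xupto v w) → T (Xpre (pos v) w)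
    earlier h = Xpre-intro (Xupto⇒X {v} h) (ℕ.≤∧≢⇒< (Xupto⇒pos≤ {v} h) (λ e → ne (pos-injective e)))

  Xupto-new : ∀ {v w} → T (Xupto v w) → T (Xpre (pos v) w) ⊎ w ≡ v
  Xupto-new {v} {w} h with w ≟V v
  ... | yes e = inj₂ e
  ... | no ne = inj₁ (subst T (Xupto-other ne) h)

  sumXpre : ℕ → (Vtx 4 n → ℕ) → ℕ
  sumXpre p g = sumV (λ w → if Xpre p w then g w else 0)

  sumXpre-step : ∀ v g → sumXpre (suc (pos v)) g ≡ sumXpre (pos v) g + (if X v then g v else 0)
  sumXpre-step v g = sumV-update _ _ v _
    (λ w ne → cong (λ x → if x then g w else 0) (Xupto-other ne))
    (trans (cong (λ x → if x then g v else 0) (Xupto-self v))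
           (sym (cong (_+ (if X v then g v else 0)) (if-false (Xpre-self v)))))

  module Induction (n≥4 : 4 ≤ n) (j-bound : suc (toℕ j) ≤ 2 * n ∸ 2)
                   (madj≤2n+1 : ∀ v → madjSize v ≤ suc (2 * n)) where

    in𝒱 : Vtx 4 n → ℕ
    in𝒱 w = 𝟙 (inVG (n + 2) w)

    size madjSum inV : ℕ → ℕ
    size p = sumXpre p (λ _ → 1)
    madjSum p = sumXpre p madjSize
    inV p = sumXpre p in𝒱

    target : ℕ → ℕ
    target k = 2 * n * k + ⌈ suc k /2⌉

    data BeforeJoin (k S V : ℕ) : Set where
      empty         : k ≡ 0 → BeforeJoin k S V
      single        : k ≡ 1 → n + 2 ≤ S → V ≡ 1 → BeforeJoin k S V
      pair-same-row : k ≡ 2 → 2 * n + 6 ≤ S → BeforeJoin k S V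
      pair-apart    : k ≡ 2 → 2 * n + 4 ≤ S → V ≡ 2 → BeforeJoin k S V
      several       : 3 ≤ k → BeforeJoin k S V

    data AfterJoin (k S V : ℕ) : Set where
      slack : ∀ k' → k ≡ suc k' → target k' + 5 ≤ S → AfterJoin k S V
      tight : ∀ k' → k ≡ suc k' → target k' + 3 ≤ S → V ≡ 2 → AfterJoin k S V

    Invariant : ℕ → Set
    Invariant p = (¬ Joined (Xpre p) × BeforeJoin (size p) (madjSum p) (inV p))
                ⊎ (Joined (Xpre p) × AfterJoin (size p) (madjSum p) (inV p))

    retype : ∀ (P : ℕ → ℕ → ℕ → Set) {k k' S S' V V'} → k ≡ k' → S ≡ S' → V ≡ V' → P k S V → P k' S' V'
    retype P refl refl refl x = x

    ∉𝒱 : ∀ v → 2 * n ≤ madjSize v → in𝒱 v ≡ 0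
    ∉𝒱 v h = if-false λ iv →
      ℕ.<⇒≱ n+2<2n (ℕ.≤-trans h (ℕ.≤-reflexive (ℕ.≡ᵇ⇒≡ _ _ (T-∧ʳ {pos v + (n + 2) + 2 ≤ᵇ N} iv))))
      where
      n+2<2n : n + 2 < 2 * n
      n+2<2n = subst₂ _≤_ (ℕ.+-suc n 2) (cong (n +_) (sym (ℕ.+-identityʳ n)))
                          (ℕ.+-monoʳ-≤ n (ℕ.≤-trans (ℕ.n≤1+n 3) n≥4))

    ∈𝒱 : ∀ v → pos v ≤ toℕ j → madjSize v ≡ n + 2 → in𝒱 v ≡ 1
    ∈𝒱 v pv≤j e = if-true (T-∧⁺ (ℕ.≤⇒≤ᵇ room) (ℕ.≡⇒≡ᵇ _ _ e))
      where
      room : pos v + (n + 2) + 2 ≤ 4 * n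
      room = begin
        pos v + (n + 2) + 2    ≡⟨ regroup (pos v) n ⟩
        suc (pos v) + (n + 3)  ≤⟨ ℕ.+-mono-≤ (ℕ.≤-trans (s≤s pv≤j) (ℕ.≤-trans j-bound (ℕ.m∸n≤m (2 * n) 2)))
                                             (ℕ.+-monoʳ-≤ n (ℕ.≤-trans (ℕ.n≤1+n 3) n≥4)) ⟩
        2 * n + (n + n)        ≡⟨ double n ⟩
        4 * n                  ∎
        where
        open ℕ.≤-Reasoning
        regroup : ∀ p n → p + (n + 2) + 2 ≡ suc p + (n + 3)
        regroup = solve-∀
        double : ∀ n → 2 * n + (n + n) ≡ 4 * n
        double = solve-∀

    inV≤size : ∀ q → inV q ≤ size q
    inV≤size q = sumV-mono bound
      where
      bound : ∀ w → (if Xpre q w then in𝒱 w else 0) ≤ (if Xpre q w then 1 else 0)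
      bound w with Xpre q w
      ... | true = 𝟙≤1 _
      ... | false = z≤n

    module Step (v : Vtx 4 n) (pv≤j : pos v ≤ toℕ j) (hv : T (X v)) where
      private
        p = pos v
        f = madjSize v
        ρ = proj₁ v
        cv = proj₂ v

      size-suc : ∀ {k} → size p ≡ k → size (suc p) ≡ suc k
      size-suc {k} e = trans (sumXpre-step v (λ _ → 1)) (trans (cong₂ _+_ e (if-true hv)) (ℕ.+-comm k 1))

      madjSum-grows : ∀ {x} → x ≤ madjSum p + f → x ≤ madjSum (suc p)
      madjSum-grows {x} = subst (x ≤_) (sym (trans (sumXpre-step v madjSize) (cong (madjSum p +_) (if-true hv))))

      inV-step : inV (suc p) ≡ inV p + in𝒱 v
      inV-step = trans (sumXpre-step v in𝒱) (cong (inV p +_) (if-true hv))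

      v∈Xupto : T (Xupto v v)
      v∈Xupto = Xupto-intro hv ℕ.≤-refl

      madj-when-joined : Joined (Xupto v) → ∀ {k} → size p ≡ k → 2 * n + suc k ≤ f + 2 * doubled v
      madj-when-joined J e = subst (λ x → 2 * n + x ≤ f + 2 * doubled v) (size-suc e) (madj-after-join v hv J)

      doubled-when-sized : ∀ {k} → size p ≡ k → 2 * doubled v ≤ suc k
      doubled-when-sized e = subst (2 * doubled v ≤_) (size-suc e) (2*doubled≤ v)

      after-step : Joined (Xpre p) → AfterJoin (size p) (madjSum p) (inV p) → Invariant (suc p)
      after-step (y , ha , hb) bound = inj₂ (J , grow bound)
        where
        J : Joined (Xupto v)
        J = y , Xpre-suc {p} ha , Xpre-suc {p} hb
        grow : AfterJoin (size p) (madjSum p) (inV p) → AfterJoin (size (suc p)) (madjSum (suc p)) (inV (suc p))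
        grow (slack k ek hS) = slack (suc k) (size-suc ek) (madjSum-grows
          (after-join-arith n k _ f (doubled v) 5 (doubled-when-sized ek) hS (madj-when-joined J ek)))
        grow (tight k ek hS hV) =
          tight (suc k) (size-suc ek)
            (madjSum-grows (after-join-arith n k _ f (doubled v) 3 (doubled-when-sized ek) hS (madj-when-joined J ek)))
            (trans inV-step (cong₂ _+_ hV (∉𝒱 v 2n≤f)))
          where
          2n≤f : 2 * n ≤ f
          2n≤f = ℕ.+-cancelʳ-≤ (suc (suc k)) _ _
                   (ℕ.≤-trans (madj-when-joined J ek) (ℕ.+-monoʳ-≤ f (doubled-when-sized ek)))

      doubled≤1 : ¬ Joined (Xpre p) → doubled v ≤ 1
      doubled≤1 unjoined = ℕ.≤-trans (sumFin-≤-except _ (λ _ → 0) cv 1 elsewhere (𝟙≤1 _))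
                                     (ℕ.≤-reflexive (cong (_+ 1) (sumFin-zero {n} (λ _ → refl))))
        where
        elsewhere : ∀ x → x ≢ cv → doubledAt v x ≤ 0
        elsewhere x ne = ℕ.≤-reflexive (if-false λ h →
          both-old (Xupto-new {v} (T-∧ˡ {Xupto v (a , x)} h)) (Xupto-new {v} (T-∧ʳ {Xupto v (a , x)} h)))
          where
          both-old : T (Xpre p (a , x)) ⊎ (a , x) ≡ v → T (Xpre p (b , x)) ⊎ (b , x) ≡ v → ⊥
          both-old (inj₁ ha) (inj₁ hb) = unjoined (x , ha , hb)
          both-old (inj₂ e) _ = ne (cong proj₂ e)
          both-old _ (inj₂ e) = ne (cong proj₂ e)

      join-step : ¬ Joined (Xpre p) → BeforeJoin (size p) (madjSum p) (inV p) → Joined (Xupto v) → Invariant (suc p)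
      join-step unjoined before J@(y , ha , hb) = inj₂ (J , after before)
        where
        madj≥ : ∀ {k} → size p ≡ k → 2 * n + k ≤ suc f
        madj≥ {k} e = join-madj-arith n k f (doubled v) (madj-when-joined J e) (doubled≤1 unjoined)
        2n+1≤f : size p ≡ 2 → 2 * n + 1 ≤ f
        2n+1≤f e = ℕ.≤-pred (subst (_≤ suc f) (ℕ.+-suc (2 * n) 1) (madj≥ e))
        after : BeforeJoin (size p) (madjSum p) (inV p) → AfterJoin (size (suc p)) (madjSum (suc p)) (inV (suc p))
        after (empty e) with Xupto-new {v} ha | Xupto-new {v} hb
        ... | inj₁ h | _ = ⊥-elim (ℕ.<-irrefl refl (subst (1 ≤_) e (countV-≥-member (Xpre p) h)))
        ... | inj₂ _ | inj₁ h = ⊥-elim (ℕ.<-irrefl refl (subst (1 ≤_) e (countV-≥-member (Xpre p) h)))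
        ... | inj₂ ea | inj₂ eb = ⊥-elim (b≢a (cong proj₁ (trans eb (sym ea))))
        after (single e hS _) = slack 1 (size-suc e)
          (madjSum-grows (join-single-arith n _ f n≥4 hS (ℕ.≤-pred (subst (_≤ suc f) (ℕ.+-comm (2 * n) 1) (madj≥ e)))))
        after (pair-same-row e hS) = slack 2 (size-suc e) (madjSum-grows (join-pair-arith n _ f 5 hS (2n+1≤f e)))
        after (pair-apart e hS hV) =
          tight 2 (size-suc e) (madjSum-grows (join-pair-arith n _ f 3 hS (2n+1≤f e)))
                (trans inV-step (cong₂ _+_ hV (∉𝒱 v (ℕ.≤-trans (ℕ.m≤m+n (2 * n) 1) (2n+1≤f e)))))
        after (several 3≤k) = ⊥-elim (ℕ.<⇒≱ (s≤s (madj≤2n+1 v)) (ℕ.≤-pred (begin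
          suc (suc (suc (2 * n)))  ≡⟨ ℕ.+-comm 3 (2 * n) ⟩
          2 * n + 3                ≤⟨ ℕ.+-monoʳ-≤ (2 * n) 3≤k ⟩
          2 * n + size p           ≤⟨ madj≥ refl ⟩
          suc f                    ∎)))
          where open ℕ.≤-Reasoning

      neighbours-later : (∀ z → T (Xpre p z) → ¬ T (G v z)) → ∀ z → T (G v z) → pos v ≤ pos z
      neighbours-later none z e with pos z ℕ.<? pos v
      ... | yes lt = ⊥-elim (none z (Xpre-intro (X-closed hv e (ℕ.≤-trans (ℕ.<⇒≤ lt) pv≤j)) lt) e)
      ... | no nlt = ℕ.≮⇒≥ nlt

      two-in-row : ∀ {x₁} → T (Xpre p x₁) → proj₁ x₁ ≡ ρ → 2 ≤ rowCount v ρ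
      two-in-row {x₁} hx₁ same-row =
        subst (_≤ rowCount v ρ) (cong₂ _+_ (if-true q₁) (if-true v∈Xupto))
          (sumFin-≥-pair (λ x → 𝟙 (Xupto v (ρ , x)))
            (λ ec → Xpre-self v (subst (λ w → T (Xpre p w)) (cong₂ _,_ same-row ec) hx₁)))
        where
        q₁ : T (Xupto v (ρ , proj₂ x₁))
        q₁ = subst (λ r → T (Xupto v (r , proj₂ x₁))) same-row (Xpre-suc {p} hx₁)

      module _ (unjoined : ¬ Joined (Xupto v)) where
        n+2≤f : n + 2 ≤ f
        n+2≤f = ℕ.≤-trans (ℕ.+-monoʳ-≤ n (ℕ.*-monoʳ-≤ 2 one-in-row)) (madj-before-join v hv unjoined)
          where
          one-in-row : 1 ≤ rowCount v ρ
          one-in-row = subst (_≤ rowCount v ρ) (if-true v∈Xupto) (sumFin-≥-term (λ x → 𝟙 (Xupto v (ρ , x))) cv)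

        first-madj : (∀ z → T (Xpre p z) → ¬ T (G v z)) → f ≡ n + 2
        first-madj none = ℕ.≤-antisym (madj≤n+2 v (neighbours-later none)) n+2≤f

        lone-earlier-not-adjacent : size p ≡ 1 → ∀ {x₁} → T (Xpre p x₁) → proj₁ x₁ ≢ ρ →
          ∀ z → T (Xpre p z) → ¬ T (G v z)
        lone-earlier-not-adjacent e {x₁} hx₁ other-row z hz adj with z ≟V x₁
        ... | no z≢x₁ = ℕ.<-irrefl refl (subst (2 ≤_) e (countV-≥-pair (Xpre p) hz hx₁ z≢x₁))
        ... | yes refl with rook-cases v z adj
        ... | inj₁ (er , _) = other-row (sym er)
        ... | inj₂ (nr , ec) with X-rows-≢ hv (Xpre⇒X {p} hz) nr
        ... | inj₁ (ea , eb) = unjoined (cv , subst (λ r → T (Xupto v (r , cv))) ea v∈Xupto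
                                             , subst (λ w → T (Xupto v w)) (cong₂ _,_ eb (sym ec)) (Xpre-suc {p} hz))
        ... | inj₂ (eb , ea) = unjoined (cv , subst (λ w → T (Xupto v w)) (cong₂ _,_ ea (sym ec)) (Xpre-suc {p} hz)
                                             , subst (λ r → T (Xupto v (r , cv))) eb v∈Xupto)

        before-step : BeforeJoin (size p) (madjSum p) (inV p) → BeforeJoin (size (suc p)) (madjSum (suc p)) (inV (suc p))
        before-step (empty e) =
          single (size-suc e) (madjSum-grows (ℕ.≤-trans n+2≤f (ℕ.m≤n+m f (madjSum p))))
                 (trans inV-step (cong₂ _+_ (ℕ.n≤0⇒n≡0 (subst (inV p ≤_) e (inV≤size p)))
                                            (∈𝒱 v pv≤j (first-madj (λ z h _ → nothing-earlier z h)))))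
          where
          nothing-earlier : ∀ z → ¬ T (Xpre p z)
          nothing-earlier z h = ℕ.<-irrefl refl (subst (1 ≤_) e (countV-≥-member (Xpre p) h))
        before-step (single e hS hV) with countV-witness (Xpre p) (ℕ.≤-reflexive (sym e))
        ... | x₁ , hx₁ with proj₁ x₁ ≟ᶠ ρ
        ... | yes same-row = pair-same-row (size-suc e) (madjSum-grows (pair-arith n _ f 2 (2 * 2) hS
               (ℕ.≤-trans (ℕ.+-monoʳ-≤ n (ℕ.*-monoʳ-≤ 2 (two-in-row hx₁ same-row))) (madj-before-join v hv unjoined))))
        ... | no other-row = pair-apart (size-suc e) (madjSum-grows (pair-arith n _ f 2 2 hS n+2≤f))
               (trans inV-step (cong₂ _+_ hV (∈𝒱 v pv≤j (first-madj (lone-earlier-not-adjacent e hx₁ other-row)))))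
        before-step (pair-same-row e _) = several (ℕ.≤-reflexive (sym (size-suc e)))
        before-step (pair-apart e _ _) = several (ℕ.≤-reflexive (sym (size-suc e)))
        before-step (several 3≤k) =
          several (ℕ.≤-trans 3≤k (ℕ.≤-trans (ℕ.n≤1+n _) (ℕ.≤-reflexive (sym (size-suc refl)))))

      invariant-step : Invariant p → Invariant (suc p)
      invariant-step (inj₂ (joined , bound)) = after-step joined bound
      invariant-step (inj₁ (unjoined , bound)) with T? (anyFin (λ y → Xupto v (a , y) ∧ Xupto v (b , y)))
      ... | yes h with anyFin-elim (λ y → Xupto v (a , y) ∧ Xupto v (b , y)) h
      ... | y , hy = join-step unjoined bound (y , T-∧ˡ {Xupto v (a , y)} hy , T-∧ʳ {Xupto v (a , y)} hy)
      invariant-step (inj₁ (unjoined , bound)) | no none =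
        inj₁ (unjoined′ , before-step unjoined′ bound)
        where
        unjoined′ : ¬ Joined (Xupto v)
        unjoined′ (y , ha , hb) = none (anyFin-intro (λ y → Xupto v (a , y) ∧ Xupto v (b , y)) y (T-∧⁺ ha hb))

    module _ (v : Vtx 4 n) (nx : ¬ T (X v)) where
      private
        unchanged : ∀ g → sumXpre (suc (pos v)) g ≡ sumXpre (pos v) g
        unchanged g = trans (sumXpre-step v g) (trans (cong (sumXpre (pos v) g +_) (if-false nx)) (ℕ.+-identityʳ _))

        old : ∀ {w} → T (Xupto v w) → T (Xpre (pos v) w)
        old {w} h with Xupto-new {v} h
        ... | inj₁ h′ = h′
        ... | inj₂ refl = ⊥-elim (nx (Xupto⇒X {v} h))

      step-outside : Invariant (pos v) → Invariant (suc (pos v))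
      step-outside (inj₁ (unjoined , bound)) =
        inj₁ ((λ (y , ha , hb) → unjoined (y , old ha , old hb)) ,
              retype BeforeJoin (sym (unchanged (λ _ → 1))) (sym (unchanged madjSize)) (sym (unchanged in𝒱)) bound)
      step-outside (inj₂ ((y , ha , hb) , bound)) =
        inj₂ ((y , Xpre-suc {pos v} ha , Xpre-suc {pos v} hb) ,
              retype AfterJoin (sym (unchanged (λ _ → 1))) (sym (unchanged madjSize)) (sym (unchanged in𝒱)) bound)

    invariant-suc : ∀ p → p ≤ toℕ j → Invariant p → Invariant (suc p)
    invariant-suc p p≤j inv with vertexAt p (ℕ.≤-<-trans p≤j (Fin.toℕ<n j))
    ... | v , refl with T? (X v)
    ... | yes hv = Step.invariant-step v p≤j hv inv
    ... | no nx = step-outside v nx inv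

    invariant : ∀ p → p ≤ suc (toℕ j) → Invariant p
    invariant zero _ = inj₁ ((λ (y , ha , _) → ℕ.n≮0 (Xpre⇒pos< {0} ha)) ,
                             empty (sumV-zero (λ w → if-false {b = Xpre 0 w} {x = 1} (λ h → ℕ.n≮0 (Xpre⇒pos< {0} {w} h)))))
    invariant (suc p) h = invariant-suc p (ℕ.≤-pred h) (invariant p (ℕ.m≤n⇒m≤1+n (ℕ.≤-pred h)))

    private
      J₀ : ℕ
      J₀ = suc (toℕ j)

    X⇒Xpre-end : ∀ {w} → T (X w) → T (Xpre J₀ w)
    X⇒Xpre-end h = Xpre-intro h (s≤s (X⇒pos≤j h))

    X⇒Xpre-end-row : ∀ {r w} → proj₁ w ≡ r → T (X w) → T (Xpre J₀ (r , proj₂ w))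
    X⇒Xpre-end-row refl = X⇒Xpre-end

    Xpre-end : ∀ w → Xpre J₀ w ≡ X w
    Xpre-end w = T-ext (Xpre⇒X {J₀}) X⇒Xpre-end

    crossing : ∀ {w} → InComp j w → proj₁ w ≢ a →
      Σ (Vtx 4 n) λ x → Σ (Vtx 4 n) λ x′ → T (X x) × T (X x′) × T (G x x′) × proj₁ x ≢ proj₁ x′
    crossing (here _) ne = ⊥-elim (ne refl)
    crossing {w} (step {v = u} W e s) ne with proj₁ u ≟ᶠ a
    ... | yes ea = u , w , Equivalence.from (X⇔comp u) W , Equivalence.from (X⇔comp w) (step W e s) ,
                   e , (λ eq → ne (trans (sym eq) ea))
    ... | no na = crossing W na

    joined-at-end : Joined (Xpre J₀)
    joined-at-end with crossing (Equivalence.to (X⇔comp _) X-in-b) b≢a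
    ... | x , x′ , hx , hx′ , e , nr with rook-cases x x′ e
    ... | inj₁ (er , _) = ⊥-elim (nr er)
    ... | inj₂ (_ , ec) with X-rows-≢ hx hx′ nr
    ... | inj₁ (ea , eb) =
      proj₂ x , X⇒Xpre-end-row ea hx , subst (λ c → T (Xpre J₀ (b , c))) (sym ec) (X⇒Xpre-end-row eb hx′)
    ... | inj₂ (eb , ea) =
      proj₂ x′ , X⇒Xpre-end-row ea hx′ , subst (λ c → T (Xpre J₀ (b , c))) ec (X⇒Xpre-end-row eb hx)

    Bound : ℕ → Set
    Bound c = 2 * n * (countV X ∸ 1) + ⌈ countV X /2⌉ + c ≤ sumV (λ v → if X v then madjSize v else 0)

    size-end : size J₀ ≡ countV X
    size-end = sumV-cong (λ w → cong 𝟙 (Xpre-end w))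

    inV-end : inV J₀ ≡ countV (λ v → inVG (n + 2) v ∧ X v)
    inV-end = sumV-cong at
      where
      at : ∀ w → (if Xpre J₀ w then in𝒱 w else 0) ≡ 𝟙 (inVG (n + 2) w ∧ X w)
      at w rewrite Xpre-end w with X w
      ... | true = cong 𝟙 (sym (∧-identityʳ _))
      ... | false = cong 𝟙 (sym (∧-zeroʳ _))

    bound-from : ∀ k c → size J₀ ≡ suc k → target k + c ≤ madjSum J₀ → Bound c
    bound-from k c e h =
      subst (λ x → 2 * n * (x ∸ 1) + ⌈ x /2⌉ + c ≤ sumV (λ v → if X v then madjSize v else 0))
            (trans (sym e) size-end)
            (subst (target k + c ≤_) (sumV-cong (λ w → cong (λ x → if x then madjSize w else 0) (Xpre-end w))) h)

    conclusion : (countV (λ v → inVG (n + 2) v ∧ X v) ≡ 2 → Bound 3) ×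
                 (¬ countV (λ v → inVG (n + 2) v ∧ X v) ≡ 2 → Bound 5)
    conclusion with invariant J₀ ℕ.≤-refl
    ... | inj₁ (unjoined , _) = ⊥-elim (unjoined joined-at-end)
    ... | inj₂ (_ , slack k e h) =
      (λ _ → bound-from k 3 e (ℕ.≤-trans (ℕ.+-monoʳ-≤ (target k) (ℕ.m≤m+n 3 2)) h)) , (λ _ → bound-from k 5 e h)
    ... | inj₂ (_ , tight k e h hV) =
      (λ _ → bound-from k 3 e h) , (λ ne → ⊥-elim (ne (trans (sym inV-end) hV)))

mainTheorem13 : (n : ℕ) → 4 ≤ n → (α : Ordering 4 n) →
    let open Elim (rook 4 n) α in
    Nice →
    (∃ λ w → Treewidth filled w × Treewidth (rook 4 n) w) →
    (∀ v → inVG (n + 2) v ≡ prefix (countV (inVG (n + 2))) v) →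
    (j : Fin (4 * n)) →
    countV (inVG (n + 2)) + 1 ≤ suc (toℕ j) →
    suc (toℕ j) ≤ 2 * n ∸ 2 →
    (X : Vtx 4 n → Bool) →
    (∀ v → T (X v) ⇔ InComp j v) →
    rowsSpanned X ≡ 2 →
    (countV (λ v → inVG (n + 2) v ∧ X v) ≡ 2 →
       2 * n * (countV X ∸ 1) + ⌈ countV X /2⌉ + 3 ≤ sumV (λ v → if X v then madjSize v else 0))
    ×
    (¬ countV (λ v → inVG (n + 2) v ∧ X v) ≡ 2 →
       2 * n * (countV X ∸ 1) + ⌈ countV X /2⌉ + 5 ≤ sumV (λ v → if X v then madjSize v else 0))
mainTheorem13 n@(suc n') n≥4 α _ (w , tw-filled , tw-rook) _ j _ j-bound X X⇔comp two-rows =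
  TwoRowComponent.Induction.conclusion α j X X⇔comp two-rows n≥4 j-bound madj≤2n+1
  where
  open MonotoneAdjacencyBound (rook 4 n) α rook-irrefl rook-sym
  madj≤2n+1 : ∀ v → Elim.madjSize (rook 4 n) α v ≤ suc (2 * n)
  madj≤2n+1 v = ℕ.≤-trans (madjSize≤treewidth w tw-filled v) (rook4-treewidth≤ n' w tw-rook)
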